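{- For integers $n\ge m\ge1$ and $d,k,c$, let $R_{(n,m,1)}^d(k,c)$ be the number of standard Young tableaux of shape $(n,m,1)$ with exactly $d$ descents such that the last cell of the first row contains $k$ and the single cell of the third row contains $c$ (this is $0$ when no such tableau exists). Let $n>m\ge 1$, and let $d,k,c$ be integers with $n\le k\le n+m+1$, $3\le c\le n+m+1$, $2\le d\le m+1$, $c\ne k$. Then $$R_{(n,m,1)}^d(k,c)=\begin{cases}R_{(n-1,m,1)}^d(k-1,c-1)+\sum_{a<k-1}R_{(n-1,m,1)}^{d-1}(a,c-1), & \text{if } k<c-1;\\ \sum_{a<k}R_{(n-1,m,1)}^d(a,c-1), & \text{if } k=c-1;\\ R_{(n-1,m,1)}^d(k-1,c)+\sum_{a<k-1}R_{(n-1,m,1)}^{d-1}(a,c), & \text{if } c<k<n+m+1;\\ \sum_{a}R_{(n-1,m,1)}^d(a,c), & \text{if } k=n+m+1,\end{cases}$$ where the sums range over all integers $a$ satisfying the indicated bound.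
   Context: For a partition $\lambda=(\lambda_1,\lambda_2,\dots)$ of $N$, a standard Young tableau of shape $\lambda$ is a filling of the Young diagram (left-justified rows of lengths $\lambda_1\ge\lambda_2\ge\cdots$, row 1 on top) by $1,\dots,N$, each used once, increasing along rows and down columns. An entry $i$ is a descent if $i+1$ lies in a row strictly below the row of $i$; the descent number is the number of descents. -}

module Defs where

open import Data.Bool using (Bool; true; false; _∧_; if_then_else_)
open import Data.Nat using (ℕ; zero; suc; _+_; _∸_; _<ᵇ_; _≡ᵇ_)
open import Data.List using (List; []; _∷_; [_]; map; concatMap; upTo; zip; take; _++_)
open import Data.Bool.ListAction using (all; any)
open import Data.Nat.ListAction using (sum)
open import Data.Product using (_×_; _,_)

-- A filling of the Young diagram of shape (n, m, 1):
-- (first row left to right, second row left to right, the single cell of row 3).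
Filling : Set
Filling = List ℕ × List ℕ × ℕ

vals : ℕ → List ℕ
vals N = map suc (upTo N)

listsOver : List ℕ → ℕ → List (List ℕ)
listsOver vs zero    = [ [] ]
listsOver vs (suc l) = concatMap (λ v → map (v ∷_) (listsOver vs l)) vs

fillings : ℕ → ℕ → List Filling
fillings n m =
  concatMap (λ r1 → concatMap (λ r2 → map (λ r3 → (r1 , r2 , r3)) vs)
                              (listsOver vs m))
            (listsOver vs n)
  where vs = vals (n + m + 1)

increasing : List ℕ → Bool
increasing (x ∷ y ∷ xs) = (x <ᵇ y) ∧ increasing (y ∷ xs)
increasing _            = true

occ : ℕ → List ℕ → ℕ
occ v []       = 0
occ v (x ∷ xs) = if v ≡ᵇ x then suc (occ v xs) else occ v xs

entries : Filling → List ℕ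
entries (r1 , r2 , r3) = r1 ++ r2 ++ [ r3 ]

isSYT : ℕ → Filling → Bool
isSYT N (r1 , r2 , r3) =
  all (λ v → occ v (entries (r1 , r2 , r3)) ≡ᵇ 1) (vals N)
  ∧ increasing r1 ∧ increasing r2
  ∧ all (λ { (x , y) → x <ᵇ y }) (zip r1 r2)
  ∧ all (λ x → x <ᵇ r3) (take 1 r1 ++ take 1 r2)    -- first column above row 3

elem : ℕ → List ℕ → Bool
elem v xs = any (v ≡ᵇ_) xs

rowOf : Filling → ℕ → ℕ
rowOf (r1 , r2 , r3) i = if elem i r1 then 1 else if elem i r2 then 2 else 3

isDescent : Filling → ℕ → Bool
isDescent T i = rowOf T i <ᵇ rowOf T (suc i)

countᵇ : {A : Set} → (A → Bool) → List A → ℕ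
countᵇ p []       = 0
countᵇ p (x ∷ xs) = if p x then suc (countᵇ p xs) else countᵇ p xs

descents : ℕ → Filling → ℕ
descents N T = countᵇ (isDescent T) (vals (N ∸ 1))

lastOr0 : List ℕ → ℕ
lastOr0 []           = 0
lastOr0 (x ∷ [])     = x
lastOr0 (x ∷ y ∷ xs) = lastOr0 (y ∷ xs)

R : ℕ → ℕ → ℕ → ℕ → ℕ → ℕ
R n m d k c = countᵇ ok (fillings n m)
  where
    N = n + m + 1
    ok : Filling → Bool
    ok (r1 , r2 , r3) = isSYT N (r1 , r2 , r3)
                        ∧ (descents N (r1 , r2 , r3) ≡ᵇ d)
                        ∧ (lastOr0 r1 ≡ᵇ k) ∧ (r3 ≡ᵇ c)

sumBelow : ℕ → (ℕ → ℕ) → ℕ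
sumBelow b f = sum (map f (upTo b))

-- Every tableau counted by R^d_{(n,m,1)}(k,c) ends its first row in k. Deleting that
-- cell and closing the gap at k (x ↦ x − 1 for x > k) is a bijection onto the tableaux
-- of shape (n−1,m,1) whose first row ends below k, the third-row entry c becoming
-- c − 1 or c. Before the deletion k − 1 is not a descent and k is one, since k + 1
-- lies below the first row; afterwards k − 1 and k + 1 are adjacent. If k + 1 is in
-- the second row they form a descent exactly when the shortened first row ends in
-- k − 1, so the descent number is kept in that case and drops by one otherwise: the
-- two-term recursions. If k + 1 is the third-row entry, or k is the largest entry,
-- the descent number is unchanged: the pure sums.
module Submission where

open import Defs
open import Data.Bool using (Bool; true; false; _∧_; _∨_; if_then_else_) renaming (T to True)
open import Data.Bool.ListAction using (all)
open import Data.Bool.Properties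
  using (T-≡; ∨-identityʳ; ∨-zeroʳ; ∧-identityʳ; ∧-zeroʳ) renaming (_≟_ to _≟ᵇ_)
open import Data.Empty using (⊥; ⊥-elim)
open import Data.List using (List; []; _∷_; [_]; map; length; _++_; zip; take; upTo; filter; concatMap)
open import Data.List.Properties
  using (∷-injectiveʳ; applyUpTo-∷ʳ; map-++; map-cong; map-∘; map-id-local; zipWith-zeroʳ; length-map; length-++; take-map; ++-assoc)
open import Data.List.Membership.Propositional using (_∈_; find; lose)
open import Data.List.Membership.Propositional.Properties
  using (∈-map⁺; ∈-map⁻; ∈-upTo⁺; ∈-upTo⁻; ∈-filter⁺; ∈-filter⁻; ∈-concatMap⁺; ∈-concatMap⁻; ∈-++⁺ʳ)
open import Data.List.Membership.Propositional.Properties.WithK using (unique∧set⇒bag)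
open import Data.List.Relation.Binary.BagAndSetEquality using (∼bag⇒↭)
open import Data.List.Relation.Binary.Disjoint.Propositional using (Disjoint)
open import Data.List.Relation.Binary.Permutation.Propositional.Properties using (↭-length)
open import Data.List.Relation.Unary.All using (All; []; _∷_)
import Data.List.Relation.Unary.All as All
import Data.List.Relation.Unary.All.Properties as All
open import Data.List.Relation.Unary.AllPairs using ([]; _∷_)
open import Data.List.Relation.Unary.Any using (here; there)
open import Data.List.Relation.Unary.Unique.Propositional using (Unique)
open import Data.List.Relation.Unary.Unique.Propositional.Properties using (filter⁺; upTo⁺)
import Data.List.Relation.Unary.Unique.Propositional.Properties as Unique
open import Data.Nat using (ℕ; zero; suc; _+_; _∸_; _≤_; _<_; s≤s; z≤n; _<ᵇ_; _≡ᵇ_; _≟_)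
open import Data.Nat.ListAction using (sum)
open import Data.Nat.ListAction.Properties using (sum-++)
open import Data.Nat.Properties
open import Data.Nat.Tactic.RingSolver using (solve-∀)
open import Data.Product using (_×_; _,_; proj₁; proj₂; ∃)
open import Data.Sum using (_⊎_; inj₁; inj₂) renaming (map to map⊎)
open import Data.Unit using (⊤; tt)
open import Function using (_∘_)
open import Function.Bundles using (Equivalence; mk⇔)
open import Relation.Binary.Definitions using (tri<; tri≈; tri>)
open import Relation.Binary.PropositionalEquality hiding ([_])
open import Relation.Nullary using (yes; no; contradiction)

open Equivalence using (to; from)

+-swapʳ : ∀ a b c → a + b + c ≡ a + c + b
+-swapʳ = solve-∀

+-assoc-swapʳ : ∀ a b c → a + (b + c) ≡ a + c + b
+-assoc-swapʳ = solve-∀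

+-rotate : ∀ a b c d → a + b + c + d ≡ a + c + d + b
+-rotate = solve-∀

+-interchange : ∀ a b c d → a + b + (c + d) ≡ a + c + (b + d)
+-interchange = solve-∀

∧-intro : ∀ {a b} → a ≡ true → b ≡ true → a ∧ b ≡ true
∧-intro refl refl = refl

∧-projˡ : ∀ {a b} → a ∧ b ≡ true → a ≡ true
∧-projˡ {true} _ = refl

∧-projʳ : ∀ {a b} → a ∧ b ≡ true → b ≡ true
∧-projʳ {true} b≡true = b≡true

∨-introˡ : ∀ {a b} → a ≡ true → a ∨ b ≡ true
∨-introˡ refl = refl

∨-introʳ : ∀ {a b} → b ≡ true → a ∨ b ≡ true
∨-introʳ {a} refl = ∨-zeroʳ a

≡ᵇ-true⇒≡ : ∀ m n → (m ≡ᵇ n) ≡ true → m ≡ n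
≡ᵇ-true⇒≡ m n e = ≡ᵇ⇒≡ m n (from T-≡ e)

≡⇒≡ᵇ-true : ∀ {m n} → m ≡ n → (m ≡ᵇ n) ≡ true
≡⇒≡ᵇ-true {m} {n} e = to T-≡ (≡⇒≡ᵇ m n e)

≡ᵇ-false⇒≢ : ∀ m n → (m ≡ᵇ n) ≡ false → m ≢ n
≡ᵇ-false⇒≢ m n e m≡n = subst True e (≡⇒≡ᵇ m n m≡n)

≢⇒≡ᵇ-false : ∀ m n → m ≢ n → (m ≡ᵇ n) ≡ false
≢⇒≡ᵇ-false m n m≢n with m ≡ᵇ n in e
... | true  = contradiction (≡ᵇ-true⇒≡ m n e) m≢n
... | false = refl

<ᵇ-true⇒< : ∀ m n → (m <ᵇ n) ≡ true → m < n
<ᵇ-true⇒< m n e = <ᵇ⇒< m n (from T-≡ e)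

<⇒<ᵇ-true : ∀ {m n} → m < n → (m <ᵇ n) ≡ true
<⇒<ᵇ-true m<n = to T-≡ (<⇒<ᵇ m<n)

≥⇒<ᵇ-false : ∀ {m n} → n ≤ m → (m <ᵇ n) ≡ false
≥⇒<ᵇ-false {m} {n} n≤m with m <ᵇ n in e
... | true  = contradiction (<ᵇ-true⇒< m n e) (≤⇒≯ n≤m)
... | false = refl

≡ᵇ-cong-⇔ : ∀ a b c d → (a ≡ b → c ≡ d) → (c ≡ d → a ≡ b) → (a ≡ᵇ b) ≡ (c ≡ᵇ d)
≡ᵇ-cong-⇔ a b c d f g with a ≡ᵇ b in e₁ | c ≡ᵇ d in e₂
... | true  | true  = refl
... | false | false = refl
... | true  | false = ⊥-elim (≡ᵇ-false⇒≢ c d e₂ (f (≡ᵇ-true⇒≡ a b e₁)))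
... | false | true  = ⊥-elim (≡ᵇ-false⇒≢ a b e₁ (g (≡ᵇ-true⇒≡ c d e₂)))

-- punchIn k opens a gap at k and punchOut k closes it again: the relabellings
-- of {1, …, N} when the entry k is inserted into or deleted from a tableau.
punchIn : ℕ → ℕ → ℕ
punchIn zero    x       = suc x
punchIn (suc k) zero    = zero
punchIn (suc k) (suc x) = suc (punchIn k x)

punchOut : ℕ → ℕ → ℕ
punchOut zero    zero    = zero
punchOut zero    (suc x) = x
punchOut (suc k) zero    = zero
punchOut (suc k) (suc x) = suc (punchOut k x)

punchOut-punchIn : ∀ k x → punchOut k (punchIn k x) ≡ x
punchOut-punchIn zero    x       = refl
punchOut-punchIn (suc k) zero    = refl
punchOut-punchIn (suc k) (suc x) = cong suc (punchOut-punchIn k x)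

punchIn-punchOut : ∀ k x → x ≢ k → punchIn k (punchOut k x) ≡ x
punchIn-punchOut zero    zero    x≢k = contradiction refl x≢k
punchIn-punchOut zero    (suc x) _   = refl
punchIn-punchOut (suc k) zero    _   = refl
punchIn-punchOut (suc k) (suc x) x≢k = cong suc (punchIn-punchOut k x (x≢k ∘ cong suc))

punchIn≢ : ∀ k x → punchIn k x ≢ k
punchIn≢ zero    x       ()
punchIn≢ (suc k) zero    ()
punchIn≢ (suc k) (suc x) e = punchIn≢ k x (suc-injective e)

punchIn-mono-< : ∀ k {x y} → x < y → punchIn k x < punchIn k y
punchIn-mono-< zero    x<y                 = s≤s x<y
punchIn-mono-< (suc k) {zero}  {suc y} _   = s≤s z≤n
punchIn-mono-< (suc k) {suc x} {suc y} (s≤s x<y) = s≤s (punchIn-mono-< k x<y)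

punchOut-mono-< : ∀ k {x y} → x < y → x ≢ k → y ≢ k → punchOut k x < punchOut k y
punchOut-mono-< zero    {zero}  {suc y} _ x≢k _ = contradiction refl x≢k
punchOut-mono-< zero    {suc x} {suc y} (s≤s x<y) _ _ = x<y
punchOut-mono-< (suc k) {zero}  {suc y} _ _ _ = s≤s z≤n
punchOut-mono-< (suc k) {suc x} {suc y} (s≤s x<y) x≢k y≢k =
  s≤s (punchOut-mono-< k x<y (λ e → x≢k (cong suc e)) (λ e → y≢k (cong suc e)))

punchIn-< : ∀ k x → x < k → punchIn k x ≡ x
punchIn-< (suc k) zero    _         = refl
punchIn-< (suc k) (suc x) (s≤s x<k) = cong suc (punchIn-< k x x<k)

punchIn-≥ : ∀ k x → k ≤ x → punchIn k x ≡ suc x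
punchIn-≥ zero    x       _         = refl
punchIn-≥ (suc k) (suc x) (s≤s k≤x) = cong suc (punchIn-≥ k x k≤x)

punchOut-≤ : ∀ k x → x ≤ k → punchOut k x ≡ x
punchOut-≤ zero    zero    _         = refl
punchOut-≤ (suc k) zero    _         = refl
punchOut-≤ (suc k) (suc x) (s≤s x≤k) = cong suc (punchOut-≤ k x x≤k)

punchOut-> : ∀ k x → k < x → suc (punchOut k x) ≡ x
punchOut-> zero    (suc x) _         = refl
punchOut-> (suc k) (suc x) (s≤s k<x) = cong suc (punchOut-> k x k<x)

punchIn-≤suc : ∀ k x → punchIn k x ≤ suc x
punchIn-≤suc zero    x       = ≤-refl
punchIn-≤suc (suc k) zero    = z≤n
punchIn-≤suc (suc k) (suc x) = s≤s (punchIn-≤suc k x)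

≤-punchIn : ∀ k x → x ≤ punchIn k x
≤-punchIn zero    x       = n≤1+n x
≤-punchIn (suc k) zero    = z≤n
≤-punchIn (suc k) (suc x) = s≤s (≤-punchIn k x)

≡ᵇ-punchIn : ∀ k v x → v ≢ k → (v ≡ᵇ punchIn k x) ≡ (punchOut k v ≡ᵇ x)
≡ᵇ-punchIn k v x v≢k = ≡ᵇ-cong-⇔ _ _ _ _
  (λ e → trans (cong (punchOut k) e) (punchOut-punchIn k x))
  (λ e → trans (sym (punchIn-punchOut k v v≢k)) (cong (punchIn k) e))

≡ᵇ-punchOut : ∀ k v x → x ≢ k → (v ≡ᵇ punchOut k x) ≡ (punchIn k v ≡ᵇ x)
≡ᵇ-punchOut k v x x≢k = ≡ᵇ-cong-⇔ _ _ _ _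
  (λ e → trans (cong (punchIn k) e) (punchIn-punchOut k x x≢k))
  (λ e → trans (sym (punchOut-punchIn k v)) (cong (punchOut k) e))

punchIn-bounds : ∀ k {x M} → 1 ≤ x → x ≤ M → 1 ≤ punchIn k x × punchIn k x ≤ suc M
punchIn-bounds k {x} 1≤x x≤M = ≤-trans 1≤x (≤-punchIn k x) , ≤-trans (punchIn-≤suc k x) (s≤s x≤M)

punchOut-bounds : ∀ {k x M} → 1 ≤ k → k ≤ suc M → 1 ≤ x → x ≤ suc M → x ≢ k →
                  1 ≤ punchOut k x × punchOut k x ≤ M
punchOut-bounds {k} {x} {M} 1≤k k≤M 1≤x x≤M x≢k with <-cmp x k
... | tri< x<k _ _ = subst (λ y → 1 ≤ y × y ≤ M) (sym (punchOut-≤ k x (<⇒≤ x<k)))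
                       (1≤x , ≤-pred (≤-trans x<k k≤M))
... | tri≈ _ x≡k _ = contradiction x≡k x≢k
... | tri> _ _ k<x = ≤-trans 1≤k (≤-pred (subst (k <_) (sym (punchOut-> k x k<x)) k<x))
                   , ≤-pred (subst (_≤ suc M) (sym (punchOut-> k x k<x)) x≤M)

all-true⇒All : ∀ {A : Set} (p : A → Bool) xs → all p xs ≡ true → All (λ x → p x ≡ true) xs
all-true⇒All p []       _ = []
all-true⇒All p (x ∷ xs) e = ∧-projˡ e ∷ all-true⇒All p xs (∧-projʳ e)

All⇒all-true : ∀ {A : Set} (p : A → Bool) {xs} → All (λ x → p x ≡ true) xs → all p xs ≡ true
All⇒all-true p []         = refl
All⇒all-true p (px ∷ pxs) = ∧-intro px (All⇒all-true p pxs)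

occ-++ : ∀ v xs ys → occ v (xs ++ ys) ≡ occ v xs + occ v ys
occ-++ v []       ys = refl
occ-++ v (x ∷ xs) ys with v ≡ᵇ x
... | true  = cong suc (occ-++ v xs ys)
... | false = occ-++ v xs ys

occ-∷-self : ∀ v xs → occ v (v ∷ xs) ≡ suc (occ v xs)
occ-∷-self v xs rewrite ≡⇒≡ᵇ-true {v} refl = refl

occ-middle : ∀ v xs y ys → occ v (xs ++ y ∷ ys) ≡ occ v (xs ++ ys) + occ v [ y ]
occ-middle v xs y ys rewrite occ-++ v xs (y ∷ ys) | occ-++ v xs ys | occ-++ v [ y ] ys =
  +-assoc-swapʳ (occ v xs) (occ v [ y ]) (occ v ys)

occ-map : ∀ (f : ℕ → ℕ) v w xs → All (λ x → (v ≡ᵇ f x) ≡ (w ≡ᵇ x)) xs → occ v (map f xs) ≡ occ w xs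
occ-map f v w []       []       = refl
occ-map f v w (x ∷ xs) (e ∷ es) rewrite e with w ≡ᵇ x
... | true  = cong suc (occ-map f v w xs es)
... | false = occ-map f v w xs es

elem-map : ∀ (f : ℕ → ℕ) v w xs → All (λ x → (v ≡ᵇ f x) ≡ (w ≡ᵇ x)) xs → elem v (map f xs) ≡ elem w xs
elem-map f v w []       []       = refl
elem-map f v w (x ∷ xs) (e ∷ es) = cong₂ _∨_ e (elem-map f v w xs es)

elem-++ : ∀ v xs ys → elem v (xs ++ ys) ≡ elem v xs ∨ elem v ys
elem-++ v []       ys = refl
elem-++ v (x ∷ xs) ys rewrite elem-++ v xs ys with v ≡ᵇ x
... | true  = refl
... | false = refl

occ≡0⇒All≢ : ∀ v xs → occ v xs ≡ 0 → All (_≢ v) xs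
occ≡0⇒All≢ v []       _ = []
occ≡0⇒All≢ v (x ∷ xs) e with v ≡ᵇ x in v≡ᵇx
... | true  = contradiction e 1+n≢0
... | false = (λ x≡v → ≡ᵇ-false⇒≢ v x v≡ᵇx (sym x≡v)) ∷ occ≡0⇒All≢ v xs e

All≢⇒elem-false : ∀ v xs → All (_≢ v) xs → elem v xs ≡ false
All≢⇒elem-false v []       []           = refl
All≢⇒elem-false v (x ∷ xs) (x≢v ∷ xs≢v)
  rewrite ≢⇒≡ᵇ-false v x (x≢v ∘ sym) = All≢⇒elem-false v xs xs≢v

All≢⇒occ≡0 : ∀ v xs → All (_≢ v) xs → occ v xs ≡ 0
All≢⇒occ≡0 v []       []           = refl
All≢⇒occ≡0 v (x ∷ xs) (x≢v ∷ xs≢v)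
  rewrite ≢⇒≡ᵇ-false v x (x≢v ∘ sym) = All≢⇒occ≡0 v xs xs≢v

occ≡0⇒elem-false : ∀ v xs → occ v xs ≡ 0 → elem v xs ≡ false
occ≡0⇒elem-false v xs e = All≢⇒elem-false v xs (occ≡0⇒All≢ v xs e)

occ≢0⇒elem-true : ∀ v xs → occ v xs ≢ 0 → elem v xs ≡ true
occ≢0⇒elem-true v []       occ≢0 = contradiction refl occ≢0
occ≢0⇒elem-true v (x ∷ xs) occ≢0 with v ≡ᵇ x
... | true  = refl
... | false = occ≢0⇒elem-true v xs occ≢0

increasing-All≤lastOr0 : ∀ xs → increasing xs ≡ true → All (_≤ lastOr0 xs) xs
increasing-All≤lastOr0 []           _ = []
increasing-All≤lastOr0 (x ∷ [])     _ = ≤-refl ∷ []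
increasing-All≤lastOr0 (x ∷ y ∷ xs) e with increasing-All≤lastOr0 (y ∷ xs) (∧-projʳ e)
... | y≤last ∷ xs≤last = ≤-trans (<⇒≤ (<ᵇ-true⇒< x y (∧-projˡ e))) y≤last ∷ y≤last ∷ xs≤last

increasing-map : ∀ (P : ℕ → Set) (f : ℕ → ℕ) → (∀ {x y} → P x → P y → x < y → f x < f y) →
                 ∀ xs → All P xs → increasing xs ≡ true → increasing (map f xs) ≡ true
increasing-map P f mono []           _                _ = refl
increasing-map P f mono (x ∷ [])     _                _ = refl
increasing-map P f mono (x ∷ y ∷ xs) (px ∷ py ∷ pxs) e =
  ∧-intro (<⇒<ᵇ-true (mono px py (<ᵇ-true⇒< x y (∧-projˡ e))))
          (increasing-map P f mono (y ∷ xs) (py ∷ pxs) (∧-projʳ e))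

increasing-∷ʳ⁺ : ∀ xs z → increasing xs ≡ true → All (_< z) xs → increasing (xs ++ [ z ]) ≡ true
increasing-∷ʳ⁺ []           z _ _              = refl
increasing-∷ʳ⁺ (x ∷ [])     z _ (x<z ∷ _)      = ∧-intro (<⇒<ᵇ-true x<z) refl
increasing-∷ʳ⁺ (x ∷ y ∷ xs) z e (_ ∷ ys<z)     = ∧-intro (∧-projˡ e) (increasing-∷ʳ⁺ (y ∷ xs) z (∧-projʳ e) ys<z)

increasing-∷ʳ⁻ : ∀ xs z → increasing (xs ++ [ z ]) ≡ true → increasing xs ≡ true
increasing-∷ʳ⁻ []           z _ = refl
increasing-∷ʳ⁻ (x ∷ [])     z _ = refl
increasing-∷ʳ⁻ (x ∷ y ∷ xs) z e = ∧-intro (∧-projˡ e) (increasing-∷ʳ⁻ (y ∷ xs) z (∧-projʳ e))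

init : List ℕ → List ℕ
init []           = []
init (x ∷ [])     = []
init (x ∷ y ∷ xs) = x ∷ init (y ∷ xs)

init-++-lastOr0 : ∀ x xs → x ∷ xs ≡ init (x ∷ xs) ++ [ lastOr0 (x ∷ xs) ]
init-++-lastOr0 x []       = refl
init-++-lastOr0 x (y ∷ xs) = cong (x ∷_) (init-++-lastOr0 y xs)

init-∷ʳ : ∀ xs z → init (xs ++ [ z ]) ≡ xs
init-∷ʳ []           z = refl
init-∷ʳ (x ∷ [])     z = refl
init-∷ʳ (x ∷ y ∷ xs) z = cong (x ∷_) (init-∷ʳ (y ∷ xs) z)

lastOr0-∷ʳ : ∀ xs z → lastOr0 (xs ++ [ z ]) ≡ z
lastOr0-∷ʳ []           z = refl
lastOr0-∷ʳ (x ∷ [])     z = refl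
lastOr0-∷ʳ (x ∷ y ∷ xs) z = lastOr0-∷ʳ (y ∷ xs) z

All-lastOr0 : ∀ {P : ℕ → Set} xs → xs ≢ [] → All P xs → P (lastOr0 xs)
All-lastOr0 []           xs≢[] _          = contradiction refl xs≢[]
All-lastOr0 (x ∷ [])     _     (px ∷ _)   = px
All-lastOr0 (x ∷ y ∷ xs) _     (_ ∷ pxs)  = All-lastOr0 (y ∷ xs) (λ ()) pxs

-- v ≢ 0 because lastOr0 [] = 0.
elem-increasing : ∀ v xs → v ≢ 0 → increasing xs ≡ true → All (_≤ v) xs →
                  elem v xs ≡ (lastOr0 xs ≡ᵇ v)
elem-increasing v []           v≢0 _ _ = sym (≢⇒≡ᵇ-false 0 v (v≢0 ∘ sym))
elem-increasing v (x ∷ [])     _   _ _ =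
  trans (∨-identityʳ _) (≡ᵇ-cong-⇔ v x x v sym sym)
elem-increasing v (x ∷ y ∷ xs) v≢0 e (x≤v ∷ y≤v ∷ xs≤v) =
  trans (cong (_∨ elem v (y ∷ xs))
              (≢⇒≡ᵇ-false v x (λ v≡x → <⇒≱ (<ᵇ-true⇒< x y (∧-projˡ e)) (subst (y ≤_) v≡x y≤v))))
        (elem-increasing v (y ∷ xs) v≢0 (∧-projʳ e) (y≤v ∷ xs≤v))

zip-∷ʳ : ∀ (xs ys : List ℕ) z → length ys ≤ length xs → zip (xs ++ [ z ]) ys ≡ zip xs ys
zip-∷ʳ xs       []       z _         = trans (zipWith-zeroʳ _ (xs ++ [ z ])) (sym (zipWith-zeroʳ _ xs))
zip-∷ʳ (x ∷ xs) (y ∷ ys) z (s≤s len≤) = cong ((x , y) ∷_) (zip-∷ʳ xs ys z len≤)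

ColumnsIncrease : List ℕ → List ℕ → Set
ColumnsIncrease xs ys = All (λ xy → proj₁ xy < proj₂ xy) (zip xs ys)

all-true⇒ColumnsIncrease : ∀ (P : ℕ × ℕ → Bool) → (∀ x y → P (x , y) ≡ (x <ᵇ y)) →
                           ∀ xs ys → all P (zip xs ys) ≡ true → ColumnsIncrease xs ys
all-true⇒ColumnsIncrease P P≗<ᵇ []       ys       e = []
all-true⇒ColumnsIncrease P P≗<ᵇ (x ∷ xs) []       e = []
all-true⇒ColumnsIncrease P P≗<ᵇ (x ∷ xs) (y ∷ ys) e =
  <ᵇ-true⇒< x y (trans (sym (P≗<ᵇ x y)) (∧-projˡ e)) ∷ all-true⇒ColumnsIncrease P P≗<ᵇ xs ys (∧-projʳ e)

ColumnsIncrease⇒all-true : ∀ (P : ℕ × ℕ → Bool) → (∀ x y → P (x , y) ≡ (x <ᵇ y)) →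
                           ∀ xs ys → ColumnsIncrease xs ys → all P (zip xs ys) ≡ true
ColumnsIncrease⇒all-true P P≗<ᵇ []       ys       _          = refl
ColumnsIncrease⇒all-true P P≗<ᵇ (x ∷ xs) []       _          = refl
ColumnsIncrease⇒all-true P P≗<ᵇ (x ∷ xs) (y ∷ ys) (x<y ∷ cs) =
  ∧-intro (trans (P≗<ᵇ x y) (<⇒<ᵇ-true x<y)) (ColumnsIncrease⇒all-true P P≗<ᵇ xs ys cs)

ColumnsIncrease-map : ∀ (g f : ℕ → ℕ) (P Q : ℕ → Set) → (∀ {x y} → P x → Q y → x < y → g x < f y) →
                      ∀ xs ys → All P xs → All Q ys → ColumnsIncrease xs ys →
                      ColumnsIncrease (map g xs) (map f ys)
ColumnsIncrease-map g f P Q mono []       ys       _          _          _          = []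
ColumnsIncrease-map g f P Q mono (x ∷ xs) []       _          _          _          = []
ColumnsIncrease-map g f P Q mono (x ∷ xs) (y ∷ ys) (px ∷ pxs) (qy ∷ qys) (x<y ∷ cs) =
  mono px qy x<y ∷ ColumnsIncrease-map g f P Q mono xs ys pxs qys cs

∈vals⇒bounds : ∀ {N v} → v ∈ vals N → 1 ≤ v × v ≤ N
∈vals⇒bounds v∈ with ∈-map⁻ suc v∈
... | u , u∈ , refl = s≤s z≤n , ∈-upTo⁻ u∈

bounds⇒∈vals : ∀ {N v} → 1 ≤ v → v ≤ N → v ∈ vals N
bounds⇒∈vals {N} {suc v} _ v≤N = ∈-map⁺ suc (∈-upTo⁺ v≤N)

bit : Bool → ℕ
bit true  = 1
bit false = 0

countᵇ-∷ : ∀ {A : Set} (p : A → Bool) x xs → countᵇ p (x ∷ xs) ≡ bit (p x) + countᵇ p xs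
countᵇ-∷ p x xs with p x
... | true  = refl
... | false = refl

countᵇ-[] : ∀ {A : Set} (p : A → Bool) x → countᵇ p [ x ] ≡ bit (p x)
countᵇ-[] p x with p x
... | true  = refl
... | false = refl

countᵇ-++ : ∀ {A : Set} (p : A → Bool) xs ys → countᵇ p (xs ++ ys) ≡ countᵇ p xs + countᵇ p ys
countᵇ-++ p []       ys = refl
countᵇ-++ p (x ∷ xs) ys = trans (countᵇ-∷ p x (xs ++ ys))
  (trans (cong (bit (p x) +_) (countᵇ-++ p xs ys))
  (trans (sym (+-assoc (bit (p x)) _ _)) (cong (_+ countᵇ p ys) (sym (countᵇ-∷ p x xs)))))

vals-suc : ∀ M → vals (suc M) ≡ vals M ++ [ suc M ]
vals-suc M = trans (cong (map suc) (sym (applyUpTo-∷ʳ (λ x → x) M))) (map-++ suc (upTo M) [ M ])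

countᵇ-vals-suc : ∀ (p : ℕ → Bool) M → countᵇ p (vals (suc M)) ≡ countᵇ p (vals M) + bit (p (suc M))
countᵇ-vals-suc p M = begin
  countᵇ p (vals (suc M))                          ≡⟨ cong (countᵇ p) (vals-suc M) ⟩
  countᵇ p (vals M ++ [ suc M ])                   ≡⟨ countᵇ-++ p (vals M) [ suc M ] ⟩
  countᵇ p (vals M) + countᵇ p [ suc M ]           ≡⟨ cong (countᵇ p (vals M) +_) (countᵇ-[] p (suc M)) ⟩
  countᵇ p (vals M) + bit (p (suc M))              ∎
  where open ≡-Reasoning

countᵇ-vals-cong : ∀ (p q : ℕ → Bool) M → (∀ i → 1 ≤ i → i ≤ M → p i ≡ q i) →
                   countᵇ p (vals M) ≡ countᵇ q (vals M)
countᵇ-vals-cong p q zero    _   = refl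
countᵇ-vals-cong p q (suc M) p≗q = begin
  countᵇ p (vals (suc M))              ≡⟨ countᵇ-vals-suc p M ⟩
  countᵇ p (vals M) + bit (p (suc M))  ≡⟨ cong₂ _+_ below (cong bit (p≗q (suc M) (s≤s z≤n) ≤-refl)) ⟩
  countᵇ q (vals M) + bit (q (suc M))  ≡⟨ sym (countᵇ-vals-suc q M) ⟩
  countᵇ q (vals (suc M))              ∎
  where
  open ≡-Reasoning
  below = countᵇ-vals-cong p q M (λ i 1≤i i≤M → p≗q i 1≤i (m≤n⇒m≤1+n i≤M))

countᵇ≡length-filter : ∀ {A : Set} (p : A → Bool) xs → countᵇ p xs ≡ length (filter (λ x → p x ≟ᵇ true) xs)
countᵇ≡length-filter p []       = refl
countᵇ≡length-filter p (x ∷ xs) with p x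
... | true  = cong suc (countᵇ≡length-filter p xs)
... | false = countᵇ≡length-filter p xs

map⁺-injectiveOn : ∀ {A B : Set} (f : A → B) {xs : List A} → Unique xs →
                   (∀ {x y} → x ∈ xs → y ∈ xs → f x ≡ f y → x ≡ y) → Unique (map f xs)
map⁺-injectiveOn f []                  inj = []
map⁺-injectiveOn f {x ∷ xs} (x∉ ∷ uxs) inj =
  fx∉ xs x∉ there ∷ map⁺-injectiveOn f uxs (λ a b → inj (there a) (there b))
  where
  fx∉ : ∀ ys → All (x ≢_) ys → (∀ {y} → y ∈ ys → y ∈ x ∷ xs) → All (f x ≢_) (map f ys)
  fx∉ []       []          _   = []
  fx∉ (y ∷ ys) (x≢y ∷ x∉ys) sub =
    (λ e → x≢y (inj (here refl) (sub (here refl)) e)) ∷ fx∉ ys x∉ys (sub ∘ there)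

countᵇ-bijection : ∀ {A B : Set} (xs : List A) (ys : List B) (p : A → Bool) (q : B → Bool)
  (f : A → B) (g : B → A) → Unique xs → Unique ys →
  (∀ {x} → x ∈ xs → p x ≡ true → f x ∈ ys × q (f x) ≡ true × g (f x) ≡ x) →
  (∀ {y} → y ∈ ys → q y ≡ true → g y ∈ xs × p (g y) ≡ true × f (g y) ≡ y) →
  countᵇ p xs ≡ countᵇ q ys
countᵇ-bijection xs ys p q f g uxs uys fwd bwd = begin
  countᵇ p xs                   ≡⟨ countᵇ≡length-filter p xs ⟩
  length (filter p? xs)         ≡⟨ sym (length-map f (filter p? xs)) ⟩
  length (map f (filter p? xs)) ≡⟨ ↭-length (∼bag⇒↭ (unique∧set⇒bag unique-image unique-q (mk⇔ image⊆ ⊆image))) ⟩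
  length (filter q? ys)         ≡⟨ sym (countᵇ≡length-filter q ys) ⟩
  countᵇ q ys                   ∎
  where
  open ≡-Reasoning
  p? = λ x → p x ≟ᵇ true
  q? = λ y → q y ≟ᵇ true
  unique-image : Unique (map f (filter p? xs))
  unique-image = map⁺-injectiveOn f (filter⁺ p? uxs) λ a b fa≡fb →
    let (a∈ , pa) = ∈-filter⁻ p? a ; (b∈ , pb) = ∈-filter⁻ p? b in
    trans (sym (proj₂ (proj₂ (fwd a∈ pa)))) (trans (cong g fa≡fb) (proj₂ (proj₂ (fwd b∈ pb))))
  unique-q : Unique (filter q? ys)
  unique-q = filter⁺ q? uys
  image⊆ : ∀ {z} → z ∈ map f (filter p? xs) → z ∈ filter q? ys
  image⊆ z∈ with ∈-map⁻ f z∈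
  ... | x , x∈ , refl = let (x∈xs , px) = ∈-filter⁻ p? x∈ ; (fx∈ , qfx , _) = fwd x∈xs px in
                        ∈-filter⁺ q? fx∈ qfx
  ⊆image : ∀ {z} → z ∈ filter q? ys → z ∈ map f (filter p? xs)
  ⊆image z∈ = let (z∈ys , qz) = ∈-filter⁻ q? z∈ ; (gz∈ , pgz , fgz) = bwd z∈ys qz in
              subst (_∈ map f (filter p? xs)) fgz (∈-map⁺ f (∈-filter⁺ p? gz∈ pgz))

-- Enumerating fillings

∈-concatMap⁺′ : ∀ {A B : Set} (f : A → List B) {xs x y} → x ∈ xs → y ∈ f x → y ∈ concatMap f xs
∈-concatMap⁺′ f x∈ y∈ = ∈-concatMap⁺ f (lose x∈ y∈)

∈-concatMap⁻′ : ∀ {A B : Set} (f : A → List B) {xs y} → y ∈ concatMap f xs → ∃ λ x → x ∈ xs × y ∈ f x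
∈-concatMap⁻′ f y∈ = find (∈-concatMap⁻ f y∈)

concatMap⁺-unique : ∀ {A B : Set} (f : A → List B) (h : B → A) {xs : List A} → Unique xs →
                    (∀ x → Unique (f x)) → (∀ x y → y ∈ f x → h y ≡ x) → Unique (concatMap f xs)
concatMap⁺-unique f h {[]}     []          uf hf = []
concatMap⁺-unique f h {x ∷ xs} (x∉ ∷ uxs) uf hf = Unique.++⁺ (uf x) (concatMap⁺-unique f h uxs uf hf) disjoint
  where
  disjoint : Disjoint (f x) (concatMap f xs)
  disjoint (y∈fx , y∈rest) with ∈-concatMap⁻′ f y∈rest
  ... | x′ , x′∈ , y∈fx′ = All.lookup x∉ x′∈ (trans (sym (hf x _ y∈fx)) (hf x′ _ y∈fx′))

headOr0 : List ℕ → ℕ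
headOr0 []      = 0
headOr0 (x ∷ _) = x

listsOver-unique : ∀ {vs} → Unique vs → ∀ l → Unique (listsOver vs l)
listsOver-unique uvs zero    = [] ∷ []
listsOver-unique {vs} uvs (suc l) =
  concatMap⁺-unique (λ v → map (v ∷_) (listsOver vs l)) headOr0 uvs
    (λ v → Unique.map⁺ ∷-injectiveʳ (listsOver-unique uvs l))
    (λ v y y∈ → let (_ , _ , y≡) = ∈-map⁻ (v ∷_) y∈ in cong headOr0 y≡)

vals-unique : ∀ N → Unique (vals N)
vals-unique N = Unique.map⁺ suc-injective (upTo⁺ N)

fillings-unique : ∀ n m → Unique (fillings n m)
fillings-unique n m =
  concatMap⁺-unique withRow₁ proj₁ (listsOver-unique (vals-unique N) n)
    (λ r₁ → concatMap⁺-unique (withRows r₁) (proj₁ ∘ proj₂) (listsOver-unique (vals-unique N) m)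
              (λ r₂ → Unique.map⁺ (cong (proj₂ ∘ proj₂)) (vals-unique N))
              (λ r₂ y y∈ → let (_ , _ , y≡) = ∈-map⁻ (λ r → (r₁ , r₂ , r)) y∈ in cong (proj₁ ∘ proj₂) y≡))
    (λ r₁ y y∈ → let (r₂ , _ , y∈′) = ∈-concatMap⁻′ (withRows r₁) {listsOver (vals N) m} y∈
                     (_ , _ , y≡)    = ∈-map⁻ (λ r → (r₁ , r₂ , r)) y∈′ in cong proj₁ y≡)
  where
  N = n + m + 1
  withRows : List ℕ → List ℕ → List Filling
  withRows r₁ r₂ = map (λ r → (r₁ , r₂ , r)) (vals N)
  withRow₁ : List ℕ → List Filling
  withRow₁ r₁ = concatMap (withRows r₁) (listsOver (vals N) m)

∈-listsOver⁺ : ∀ {vs : List ℕ} {xs} → All (_∈ vs) xs → xs ∈ listsOver vs (length xs)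
∈-listsOver⁺ [] = here refl
∈-listsOver⁺ {vs} {x ∷ xs} (x∈ ∷ xs∈) =
  ∈-concatMap⁺′ (λ v → map (v ∷_) (listsOver vs (length xs))) x∈ (∈-map⁺ _ (∈-listsOver⁺ xs∈))

∈-listsOver⁻ : ∀ {vs : List ℕ} l {xs} → xs ∈ listsOver vs l → length xs ≡ l × All (_∈ vs) xs
∈-listsOver⁻ zero (here refl) = refl , []
∈-listsOver⁻ {vs} (suc l) xs∈ with ∈-concatMap⁻′ (λ v → map (v ∷_) (listsOver vs l)) {vs} xs∈
... | v , v∈ , xs∈′ with ∈-map⁻ (v ∷_) xs∈′
... | ys , ys∈ , refl = let (len , ys⊆) = ∈-listsOver⁻ l ys∈ in cong suc len , v∈ ∷ ys⊆

record IsFilling (n m : ℕ) (r₁ r₂ : List ℕ) (r₃ : ℕ) : Set where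
  field
    length₁ : length r₁ ≡ n
    length₂ : length r₂ ≡ m
    range₁  : All (_∈ vals (n + m + 1)) r₁
    range₂  : All (_∈ vals (n + m + 1)) r₂
    range₃  : r₃ ∈ vals (n + m + 1)

∈-fillings⁺ : ∀ {n m r₁ r₂ r₃} → IsFilling n m r₁ r₂ r₃ → (r₁ , r₂ , r₃) ∈ fillings n m
∈-fillings⁺ {n} {m} {r₁} {r₂} record { length₁ = refl ; length₂ = refl ; range₁ = rg₁ ; range₂ = rg₂ ; range₃ = rg₃ } =
  ∈-concatMap⁺′ _ (∈-listsOver⁺ rg₁) (∈-concatMap⁺′ _ (∈-listsOver⁺ rg₂) (∈-map⁺ (λ r → (r₁ , r₂ , r)) rg₃))

∈-fillings⁻ : ∀ {n m r₁ r₂ r₃} → (r₁ , r₂ , r₃) ∈ fillings n m → IsFilling n m r₁ r₂ r₃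
∈-fillings⁻ {n} {m} T∈ with ∈-concatMap⁻′ _ {listsOver (vals (n + m + 1)) n} T∈
... | s₁ , s₁∈ , T∈′ with ∈-concatMap⁻′ _ {listsOver (vals (n + m + 1)) m} T∈′
... | s₂ , s₂∈ , T∈″ with ∈-map⁻ (λ r → (s₁ , s₂ , r)) T∈″
... | s₃ , s₃∈ , refl =
  let (len₁ , rg₁) = ∈-listsOver⁻ n s₁∈ ; (len₂ , rg₂) = ∈-listsOver⁻ m s₂∈ in
  record { length₁ = len₁ ; length₂ = len₂ ; range₁ = rg₁ ; range₂ = rg₂ ; range₃ = s₃∈ }

-- Descents

descentAt : (ℕ → ℕ) → ℕ → Bool
descentAt ρ i = ρ i <ᵇ ρ (suc i)

descentCount : (ℕ → ℕ) → ℕ → ℕ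
descentCount ρ M = countᵇ (descentAt ρ) (vals M)

-- ρ′ is the row function after deleting the entry k = t + 2: the descents of ρ
-- at k − 1 and k are traded for the single descent of ρ′ at k − 1.
module DescentsAfterDeletion (ρ ρ′ : ℕ → ℕ) (t : ℕ)
                             (ρ′≗ρ∘punchIn : ∀ j → ρ′ j ≡ ρ (punchIn (suc (suc t)) j)) where

  private
    a′ = bit (descentAt ρ′ (suc t))
    b  = bit (descentAt ρ (suc t))
    c  = bit (descentAt ρ (suc (suc t)))

  descentCount-below : descentCount ρ′ t ≡ descentCount ρ t
  descentCount-below = countᵇ-vals-cong (descentAt ρ′) (descentAt ρ) t λ i _ i≤t → cong₂ _<ᵇ_
    (trans (ρ′≗ρ∘punchIn i)       (cong ρ (punchIn-< (suc (suc t)) i (s≤s (m≤n⇒m≤1+n i≤t)))))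
    (trans (ρ′≗ρ∘punchIn (suc i)) (cong ρ (punchIn-< (suc (suc t)) (suc i) (s≤s (s≤s i≤t)))))

  descentCount-upTo-last : descentCount ρ′ t + b ≡ descentCount ρ (suc t)
  descentCount-upTo-last = trans (cong (_+ b) descentCount-below) (sym (countᵇ-vals-suc (descentAt ρ) t))

  descentCount-beyond : ∀ j → descentCount ρ′ (suc t + j) + b + c ≡ descentCount ρ (suc (suc t + j)) + a′
  descentCount-beyond zero = begin
    descentCount ρ′ (suc t + 0) + b + c  ≡⟨ cong (λ z → descentCount ρ′ z + b + c) (+-identityʳ (suc t)) ⟩
    descentCount ρ′ (suc t) + b + c      ≡⟨ cong (λ z → z + b + c) (countᵇ-vals-suc (descentAt ρ′) t) ⟩
    descentCount ρ′ t + a′ + b + c       ≡⟨ cong (λ z → z + a′ + b + c) descentCount-below ⟩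
    descentCount ρ t + a′ + b + c        ≡⟨ +-rotate (descentCount ρ t) a′ b c ⟩
    descentCount ρ t + b + c + a′        ≡⟨ cong (λ z → z + c + a′) (sym (countᵇ-vals-suc (descentAt ρ) t)) ⟩
    descentCount ρ (suc t) + c + a′      ≡⟨ cong (_+ a′) (sym (countᵇ-vals-suc (descentAt ρ) (suc t))) ⟩
    descentCount ρ (suc (suc t)) + a′    ≡⟨ cong (λ z → descentCount ρ (suc z) + a′) (sym (+-identityʳ (suc t))) ⟩
    descentCount ρ (suc (suc t + 0)) + a′ ∎
    where open ≡-Reasoning
  descentCount-beyond (suc j) = begin
    descentCount ρ′ (suc t + suc j) + b + c      ≡⟨ cong (λ z → descentCount ρ′ z + b + c) (+-suc (suc t) j) ⟩
    descentCount ρ′ (suc (suc t + j)) + b + c    ≡⟨ cong (λ z → z + b + c) (countᵇ-vals-suc (descentAt ρ′) (suc t + j)) ⟩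
    descentCount ρ′ (suc t + j) + e′ + b + c     ≡⟨ +-rotate (descentCount ρ′ (suc t + j)) e′ b c ⟩
    descentCount ρ′ (suc t + j) + b + c + e′     ≡⟨ cong₂ _+_ (descentCount-beyond j) shifted ⟩
    descentCount ρ (suc (suc t + j)) + a′ + e    ≡⟨ +-swapʳ (descentCount ρ (suc (suc t + j))) a′ e ⟩
    descentCount ρ (suc (suc t + j)) + e + a′    ≡⟨ cong (_+ a′) (sym (countᵇ-vals-suc (descentAt ρ) (suc (suc t + j)))) ⟩
    descentCount ρ (suc (suc (suc t + j))) + a′  ≡⟨ cong (λ z → descentCount ρ (suc z) + a′) (sym (+-suc (suc t) j)) ⟩
    descentCount ρ (suc (suc t + suc j)) + a′   ∎
    where
    open ≡-Reasoning
    e′ = bit (descentAt ρ′ (suc (suc t + j)))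
    e  = bit (descentAt ρ (suc (suc (suc t + j))))
    k≤ : suc (suc t) ≤ suc (suc t + j)
    k≤ = s≤s (s≤s (m≤m+n t j))
    shifted : e′ ≡ e
    shifted = cong bit (cong₂ _<ᵇ_
      (trans (ρ′≗ρ∘punchIn _) (cong ρ (punchIn-≥ (suc (suc t)) _ k≤)))
      (trans (ρ′≗ρ∘punchIn _) (cong ρ (punchIn-≥ (suc (suc t)) _ (m≤n⇒m≤1+n k≤)))))

-- Deleting the last entry of the first row

EachOnce : ℕ → List ℕ → Set
EachOnce N xs = ∀ v → v ∈ vals N → occ v xs ≡ 1

record SYT (N : ℕ) (r₁ r₂ : List ℕ) (r₃ : ℕ) : Set where
  field
    once         : EachOnce N (r₁ ++ r₂ ++ [ r₃ ])
    increasing₁  : increasing r₁ ≡ true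
    increasing₂  : increasing r₂ ≡ true
    columns      : ColumnsIncrease r₁ r₂
    firstColumn  : All (_< r₃) (take 1 r₁ ++ take 1 r₂)

isSYT⇒SYT : ∀ N r₁ r₂ r₃ → isSYT N (r₁ , r₂ , r₃) ≡ true → SYT N r₁ r₂ r₃
isSYT⇒SYT N r₁ r₂ r₃ h = record
  { once        = λ v v∈ → ≡ᵇ-true⇒≡ _ 1 (All.lookup (all-true⇒All _ (vals N) (∧-projˡ h)) v∈)
  ; increasing₁ = ∧-projˡ h₂
  ; increasing₂ = ∧-projˡ h₃
  ; columns     = all-true⇒ColumnsIncrease _ (λ _ _ → refl) r₁ r₂ (∧-projˡ h₄)
  ; firstColumn = All.map (λ {x} → <ᵇ-true⇒< x r₃) (all-true⇒All _ _ (∧-projʳ h₄)) }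
  where
  h₂ = ∧-projʳ {all (λ v → occ v (r₁ ++ r₂ ++ [ r₃ ]) ≡ᵇ 1) (vals N)} h
  h₃ = ∧-projʳ {increasing r₁} h₂
  h₄ = ∧-projʳ {increasing r₂} h₃

SYT⇒isSYT : ∀ N r₁ r₂ r₃ → SYT N r₁ r₂ r₃ → isSYT N (r₁ , r₂ , r₃) ≡ true
SYT⇒isSYT N r₁ r₂ r₃ syt =
  ∧-intro (All⇒all-true _ (All.tabulate λ {v} v∈ → ≡⇒≡ᵇ-true (once v v∈)))
  (∧-intro increasing₁ (∧-intro increasing₂
  (∧-intro (ColumnsIncrease⇒all-true _ (λ _ _ → refl) r₁ r₂ columns)
           (All⇒all-true _ (All.map <⇒<ᵇ-true firstColumn)))))
  where open SYT syt

take1-∷ʳ : ∀ (xs : List ℕ) z → xs ≢ [] → take 1 (xs ++ [ z ]) ≡ take 1 xs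
take1-∷ʳ []       z xs≢[] = contradiction refl xs≢[]
take1-∷ʳ (x ∷ xs) z _     = refl

2≤rowOf : ∀ r₁ r₂ r₃ v → elem v r₁ ≡ false → 2 ≤ rowOf (r₁ , r₂ , r₃) v
2≤rowOf r₁ r₂ r₃ v v∉r₁ rewrite v∉r₁ with elem v r₂
... | true  = s≤s (s≤s z≤n)
... | false = s≤s (s≤s z≤n)

rowOf-<2 : ∀ r₁ r₂ r₃ v → (rowOf (r₁ , r₂ , r₃) v <ᵇ 2) ≡ elem v r₁
rowOf-<2 r₁ r₂ r₃ v with elem v r₁ | elem v r₂
... | true  | _     = refl
... | false | true  = refl
... | false | false = refl

rowOf-<3 : ∀ r₁ r₂ r₃ v → (rowOf (r₁ , r₂ , r₃) v <ᵇ 3) ≡ elem v r₁ ∨ elem v r₂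
rowOf-<3 r₁ r₂ r₃ v with elem v r₁ | elem v r₂
... | true  | _     = refl
... | false | true  = refl
... | false | false = refl

deleteEntry : ℕ → Filling → Filling
deleteEntry k (r₁ , r₂ , r₃) = (init r₁ , map (punchOut k) r₂ , punchOut k r₃)

insertEntry : ℕ → Filling → Filling
insertEntry k (s₁ , s₂ , s₃) = (s₁ ++ [ k ] , map (punchIn k) s₂ , punchIn k s₃)

1≤rowOf : ∀ T v → 1 ≤ rowOf T v
1≤rowOf (r₁ , r₂ , r₃) v with elem v r₁ | elem v r₂
... | true  | _     = s≤s z≤n
... | false | true  = s≤s z≤n
... | false | false = s≤s z≤n

module Deletion (n′ m k : ℕ) (L₁ r₂ : List ℕ) (r₃ : ℕ) (m≤n′ : m ≤ n′) (1≤n′ : 1 ≤ n′)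
                (T∈ : (L₁ ++ [ k ] , r₂ , r₃) ∈ fillings (suc n′) m)
                (T-syt : isSYT (suc (n′ + m + 1)) (L₁ ++ [ k ] , r₂ , r₃) ≡ true) where

  N′ = n′ + m + 1
  N  = suc N′

  T : Filling
  T = (L₁ ++ [ k ] , r₂ , r₃)

  T′ : Filling
  T′ = (L₁ , map (punchOut k) r₂ , punchOut k r₃)

  open IsFilling (∈-fillings⁻ {suc n′} {m} T∈)
  open SYT (isSYT⇒SYT N (L₁ ++ [ k ]) r₂ r₃ T-syt)

  length-L₁ : length L₁ ≡ n′
  length-L₁ = suc-injective (trans (sym (trans (length-++ L₁) (+-comm (length L₁) 1))) length₁)

  L₁≢[] : L₁ ≢ []
  L₁≢[] L₁≡[] = <⇒≢ 1≤n′ (sym (trans (sym length-L₁) (cong length L₁≡[])))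

  k∈vals : k ∈ vals N
  k∈vals = All.lookup range₁ (∈-++⁺ʳ L₁ (here refl))

  1≤k : 1 ≤ k
  1≤k = proj₁ (∈vals⇒bounds k∈vals)

  k≤N : k ≤ N
  k≤N = proj₂ (∈vals⇒bounds k∈vals)

  once′ : EachOnce N (L₁ ++ [ k ] ++ r₂ ++ [ r₃ ])
  once′ v v∈ = trans (cong (occ v) (sym (++-assoc L₁ [ k ] (r₂ ++ [ r₃ ])))) (once v v∈)

  occ-by-row : ∀ v → occ v (L₁ ++ [ k ] ++ r₂ ++ [ r₃ ]) ≡ occ v (L₁ ++ [ k ]) + occ v r₂ + occ v [ r₃ ]
  occ-by-row v = begin
    occ v (L₁ ++ [ k ] ++ r₂ ++ [ r₃ ])       ≡⟨ cong (occ v) (sym (++-assoc L₁ [ k ] (r₂ ++ [ r₃ ]))) ⟩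
    occ v ((L₁ ++ [ k ]) ++ r₂ ++ [ r₃ ])     ≡⟨ cong (occ v) (sym (++-assoc (L₁ ++ [ k ]) r₂ [ r₃ ])) ⟩
    occ v (((L₁ ++ [ k ]) ++ r₂) ++ [ r₃ ])   ≡⟨ occ-++ v ((L₁ ++ [ k ]) ++ r₂) [ r₃ ] ⟩
    occ v ((L₁ ++ [ k ]) ++ r₂) + occ v [ r₃ ] ≡⟨ cong (_+ occ v [ r₃ ]) (occ-++ v (L₁ ++ [ k ]) r₂) ⟩
    occ v (L₁ ++ [ k ]) + occ v r₂ + occ v [ r₃ ] ∎
    where open ≡-Reasoning

  k-only-once : occ k L₁ + occ k (r₂ ++ [ r₃ ]) ≡ 0
  k-only-once = suc-injective (begin
    suc (occ k L₁ + occ k (r₂ ++ [ r₃ ]))            ≡⟨ sym (+-suc (occ k L₁) _) ⟩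
    occ k L₁ + suc (occ k (r₂ ++ [ r₃ ]))            ≡⟨ cong (occ k L₁ +_) (sym (occ-∷-self k (r₂ ++ [ r₃ ]))) ⟩
    occ k L₁ + occ k ([ k ] ++ r₂ ++ [ r₃ ])         ≡⟨ sym (occ-++ k L₁ ([ k ] ++ r₂ ++ [ r₃ ])) ⟩
    occ k (L₁ ++ [ k ] ++ r₂ ++ [ r₃ ])              ≡⟨ once′ k k∈vals ⟩
    1                                                ∎)
    where open ≡-Reasoning

  L₁≢k : All (_≢ k) L₁
  L₁≢k = occ≡0⇒All≢ k L₁ (m+n≡0⇒m≡0 (occ k L₁) k-only-once)

  r₂r₃≢k : All (_≢ k) (r₂ ++ [ r₃ ])
  r₂r₃≢k = occ≡0⇒All≢ k _ (m+n≡0⇒n≡0 (occ k L₁) k-only-once)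

  r₂≢k : All (_≢ k) r₂
  r₂≢k = All.++⁻ˡ r₂ r₂r₃≢k

  r₃≢k : r₃ ≢ k
  r₃≢k = All.head (All.++⁻ʳ r₂ r₂r₃≢k)

  row₁≤k : All (_≤ k) (L₁ ++ [ k ])
  row₁≤k = subst (λ z → All (_≤ z) (L₁ ++ [ k ])) (lastOr0-∷ʳ L₁ k) (increasing-All≤lastOr0 (L₁ ++ [ k ]) increasing₁)

  L₁<k : All (_< k) L₁
  L₁<k = All.zipWith (λ (x≤k , x≢k) → ≤∧≢⇒< x≤k x≢k) (All.++⁻ˡ L₁ row₁≤k , L₁≢k)

  L₁-increasing : increasing L₁ ≡ true
  L₁-increasing = increasing-∷ʳ⁻ L₁ k increasing₁

  lastOr0-L₁<k : lastOr0 L₁ < k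
  lastOr0-L₁<k = All-lastOr0 L₁ L₁≢[] L₁<k

  punchOut-L₁ : map (punchOut k) L₁ ≡ L₁
  punchOut-L₁ = map-id-local (All.map (λ {x} x<k → punchOut-≤ k x (<⇒≤ x<k)) L₁<k)

  deleteEntry-T : deleteEntry k T ≡ T′
  deleteEntry-T = cong (λ r → (r , map (punchOut k) r₂ , punchOut k r₃)) (init-∷ʳ L₁ k)

  insertEntry-T′ : insertEntry k T′ ≡ T
  insertEntry-T′ = cong₂ (λ s₂ s₃ → (L₁ ++ [ k ] , s₂ , s₃))
    (trans (sym (map-∘ r₂)) (map-id-local (All.map (λ {x} → punchIn-punchOut k x) r₂≢k)))
    (punchIn-punchOut k r₃ r₃≢k)

  punchOut-∈vals : ∀ {x} → x ∈ vals N → x ≢ k → punchOut k x ∈ vals N′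
  punchOut-∈vals x∈ x≢k = let (1≤x , x≤N) = ∈vals⇒bounds x∈ ; (lo , hi) = punchOut-bounds 1≤k k≤N 1≤x x≤N x≢k in
                          bounds⇒∈vals lo hi

  T′∈fillings : T′ ∈ fillings n′ m
  T′∈fillings = ∈-fillings⁺ record
    { length₁ = length-L₁
    ; length₂ = trans (length-map (punchOut k) r₂) length₂
    ; range₁  = All.tabulate λ {x} x∈ →
        subst (_∈ vals N′) (punchOut-≤ k x (<⇒≤ (All.lookup L₁<k x∈)))
              (punchOut-∈vals (All.lookup (All.++⁻ˡ L₁ range₁) x∈) (All.lookup L₁≢k x∈))
    ; range₂  = All.map⁺ (All.zipWith (λ (x∈ , x≢k) → punchOut-∈vals x∈ x≢k) (range₂ , r₂≢k))
    ; range₃  = punchOut-∈vals range₃ r₃≢k }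

  entries-T′ : L₁ ++ map (punchOut k) r₂ ++ [ punchOut k r₃ ] ≡ map (punchOut k) (L₁ ++ r₂ ++ [ r₃ ])
  entries-T′ = sym (trans (map-++ (punchOut k) L₁ (r₂ ++ [ r₃ ]))
                          (cong₂ _++_ punchOut-L₁ (map-++ (punchOut k) r₂ [ r₃ ])))

  occ-without-k : ∀ w → w ≢ k → occ w (L₁ ++ r₂ ++ [ r₃ ]) ≡ occ w (L₁ ++ [ k ] ++ r₂ ++ [ r₃ ])
  occ-without-k w w≢k rewrite occ-++ w L₁ (r₂ ++ [ r₃ ]) | occ-++ w L₁ ([ k ] ++ r₂ ++ [ r₃ ])
                            | ≢⇒≡ᵇ-false w k w≢k = refl

  T′-once : EachOnce N′ (L₁ ++ map (punchOut k) r₂ ++ [ punchOut k r₃ ])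
  T′-once v v∈ = begin
    occ v (L₁ ++ map (punchOut k) r₂ ++ [ punchOut k r₃ ]) ≡⟨ cong (occ v) entries-T′ ⟩
    occ v (map (punchOut k) (L₁ ++ r₂ ++ [ r₃ ]))          ≡⟨ occ-map (punchOut k) v (punchIn k v) _
                                                                (All.map (λ {x} → ≡ᵇ-punchOut k v x) (All.++⁺ L₁≢k r₂r₃≢k)) ⟩
    occ (punchIn k v) (L₁ ++ r₂ ++ [ r₃ ])                 ≡⟨ occ-without-k (punchIn k v) (punchIn≢ k v) ⟩
    occ (punchIn k v) (L₁ ++ [ k ] ++ r₂ ++ [ r₃ ])        ≡⟨ once′ (punchIn k v) (bounds⇒∈vals lo hi) ⟩
    1                                                      ∎
    where
    open ≡-Reasoning
    lo = proj₁ (punchIn-bounds k (proj₁ (∈vals⇒bounds v∈)) (proj₂ (∈vals⇒bounds v∈)))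
    hi = proj₂ (punchIn-bounds k (proj₁ (∈vals⇒bounds v∈)) (proj₂ (∈vals⇒bounds v∈)))

  T′-SYT : isSYT N′ T′ ≡ true
  T′-SYT = SYT⇒isSYT N′ L₁ (map (punchOut k) r₂) (punchOut k r₃) record
    { once        = T′-once
    ; increasing₁ = L₁-increasing
    ; increasing₂ = increasing-map (_≢ k) (punchOut k) (λ x≢k y≢k x<y → punchOut-mono-< k x<y x≢k y≢k)
                                   r₂ r₂≢k increasing₂
    ; columns     = columns′
    ; firstColumn = firstColumn′ }
    where
    columns′ : ColumnsIncrease L₁ (map (punchOut k) r₂)
    columns′ = subst (λ r → ColumnsIncrease r (map (punchOut k) r₂)) punchOut-L₁
      (ColumnsIncrease-map (punchOut k) (punchOut k) (_< k) (_≢ k)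
        (λ x<k y≢k x<y → punchOut-mono-< k x<y (<⇒≢ x<k) y≢k) L₁ r₂ L₁<k r₂≢k
        (subst (All _) (zip-∷ʳ L₁ r₂ k (subst₂ _≤_ (sym length₂) (sym length-L₁) m≤n′)) columns))
    corner : All (_< r₃) (take 1 L₁ ++ take 1 r₂)
    corner = subst (λ r → All (_< r₃) (r ++ take 1 r₂)) (take1-∷ʳ L₁ k L₁≢[]) firstColumn
    firstColumn′ : All (_< punchOut k r₃) (take 1 L₁ ++ take 1 (map (punchOut k) r₂))
    firstColumn′ = All.++⁺
      (All.zipWith (λ { {x} (x<k , x<r₃) → subst (_< punchOut k r₃) (punchOut-≤ k x (<⇒≤ x<k))
                                                  (punchOut-mono-< k x<r₃ (<⇒≢ x<k) r₃≢k) })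
                   (All.take⁺ 1 L₁<k , All.++⁻ˡ (take 1 L₁) corner))
      (subst (All (_< punchOut k r₃)) (sym (take-map 1 r₂))
        (All.map⁺ (All.zipWith (λ (y≢k , y<r₃) → punchOut-mono-< k y<r₃ y≢k r₃≢k)
                               (All.take⁺ 1 r₂≢k , All.++⁻ʳ (take 1 L₁) corner))))

  elem-L₁ : ∀ j → elem j L₁ ≡ elem (punchIn k j) (L₁ ++ [ k ])
  elem-L₁ j = begin
    elem j L₁                                 ≡⟨ cong (elem j) (sym punchOut-L₁) ⟩
    elem j (map (punchOut k) L₁)              ≡⟨ elem-map (punchOut k) j (punchIn k j) L₁ (All.map (≡ᵇ-punchOut k j _) L₁≢k) ⟩
    elem (punchIn k j) L₁                     ≡⟨ sym (∨-identityʳ _) ⟩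
    elem (punchIn k j) L₁ ∨ false             ≡⟨ cong (λ b → elem (punchIn k j) L₁ ∨ b)
                                                   (sym (trans (∨-identityʳ _) (≢⇒≡ᵇ-false _ _ (punchIn≢ k j)))) ⟩
    elem (punchIn k j) L₁ ∨ elem (punchIn k j) [ k ] ≡⟨ sym (elem-++ (punchIn k j) L₁ [ k ]) ⟩
    elem (punchIn k j) (L₁ ++ [ k ])          ∎
    where open ≡-Reasoning

  rowOf-T′ : ∀ j → rowOf T′ j ≡ rowOf T (punchIn k j)
  rowOf-T′ j = cong₂ (λ a b → if a then 1 else if b then 2 else 3) (elem-L₁ j)
    (elem-map (punchOut k) j (punchIn k j) r₂ (All.map (λ {x} → ≡ᵇ-punchOut k j x) r₂≢k))

  rowOf-k : rowOf T k ≡ 1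
  rowOf-k = cong (λ b → if b then 1 else if elem k r₂ then 2 else 3)
    (trans (elem-++ k L₁ [ k ]) (trans (cong (λ b → elem k L₁ ∨ b ∨ false) (≡⇒≡ᵇ-true {k} refl)) (∨-zeroʳ _)))

  row₁≢suc-k : All (_≢ suc k) (L₁ ++ [ k ])
  row₁≢suc-k = All.map (λ x≤k x≡ → 1+n≰n (subst (_≤ k) x≡ x≤k)) row₁≤k

  row₁₂-except-r₃ : ∀ v → v ∈ vals N → v ≢ r₃ → elem v (L₁ ++ [ k ]) ∨ elem v r₂ ≡ true
  row₁₂-except-r₃ v v∈ v≢r₃ =
    trans (sym (elem-++ v (L₁ ++ [ k ]) r₂)) (occ≢0⇒elem-true v ((L₁ ++ [ k ]) ++ r₂) λ occ≡0 → 0≢1+n (begin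
    0                                                      ≡⟨ cong₂ _+_ (sym occ≡0) (sym (All≢⇒occ≡0 v [ r₃ ] (v≢r₃ ∘ sym ∷ []))) ⟩
    occ v ((L₁ ++ [ k ]) ++ r₂) + occ v [ r₃ ]              ≡⟨ cong (_+ occ v [ r₃ ]) (occ-++ v (L₁ ++ [ k ]) r₂) ⟩
    occ v (L₁ ++ [ k ]) + occ v r₂ + occ v [ r₃ ]           ≡⟨ sym (occ-by-row v) ⟩
    occ v (L₁ ++ [ k ] ++ r₂ ++ [ r₃ ])                     ≡⟨ once′ v v∈ ⟩
    1                                                      ∎))
    where open ≡-Reasoning

  rowOf-suc-k : suc k ≢ r₃ → suc k ≤ N → rowOf T (suc k) ≡ 2
  rowOf-suc-k k+1≢r₃ k+1≤N
    with elem (suc k) (L₁ ++ [ k ]) | All≢⇒elem-false (suc k) (L₁ ++ [ k ]) row₁≢suc-k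
       | row₁₂-except-r₃ (suc k) (bounds⇒∈vals (s≤s z≤n) k+1≤N) k+1≢r₃
  ... | .false | refl | in-row₂ rewrite in-row₂ = refl

  r₃∉rows₁₂ : occ r₃ (L₁ ++ [ k ]) + occ r₃ r₂ ≡ 0
  r₃∉rows₁₂ = +-cancelʳ-≡ 1 _ 0 (trans (cong (occ r₃ (L₁ ++ [ k ]) + occ r₃ r₂ +_) (sym (occ-∷-self r₃ [])))
                                       (trans (sym (occ-by-row r₃)) (once′ r₃ range₃)))

  rowOf-r₃ : rowOf T r₃ ≡ 3
  rowOf-r₃
    rewrite occ≡0⇒elem-false r₃ (L₁ ++ [ k ]) (m+n≡0⇒m≡0 (occ r₃ (L₁ ++ [ k ])) r₃∉rows₁₂)
          | occ≡0⇒elem-false r₃ r₂ (m+n≡0⇒n≡0 (occ r₃ (L₁ ++ [ k ])) r₃∉rows₁₂) = refl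

  module Descents (t : ℕ) (k≡t+2 : k ≡ suc (suc t)) where

    ρ  = rowOf T
    ρ′ = rowOf T′

    ρ′≗ρ∘punchIn : ∀ j → ρ′ j ≡ ρ (punchIn (suc (suc t)) j)
    ρ′≗ρ∘punchIn j = subst (λ z → ρ′ j ≡ ρ (punchIn z j)) k≡t+2 (rowOf-T′ j)

    open DescentsAfterDeletion ρ ρ′ t ρ′≗ρ∘punchIn

    ρ-k : ρ (suc (suc t)) ≡ 1
    ρ-k = trans (cong ρ (sym k≡t+2)) rowOf-k

    descentAcross-k : Bool
    descentAcross-k = ρ (suc t) <ᵇ ρ (suc (suc (suc t)))

    descentAt-ρ′ : descentAt ρ′ (suc t) ≡ descentAcross-k
    descentAt-ρ′ = cong₂ _<ᵇ_
      (trans (ρ′≗ρ∘punchIn (suc t))       (cong ρ (punchIn-< (suc (suc t)) (suc t) ≤-refl)))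
      (trans (ρ′≗ρ∘punchIn (suc (suc t))) (cong ρ (punchIn-≥ (suc (suc t)) (suc (suc t)) ≤-refl)))

    no-descent-before-k : descentAt ρ (suc t) ≡ false
    no-descent-before-k = trans (cong (ρ (suc t) <ᵇ_) ρ-k) (≥⇒<ᵇ-false (1≤rowOf T (suc t)))

    descent-at-k : descentAt ρ (suc (suc t)) ≡ true
    descent-at-k = trans (cong₂ _<ᵇ_ ρ-k (cong (ρ ∘ suc) (sym k≡t+2)))
                         (<⇒<ᵇ-true (2≤rowOf (L₁ ++ [ k ]) r₂ r₃ (suc k) (All≢⇒elem-false (suc k) _ row₁≢suc-k)))

    descents-interior : suc (suc t) ≤ N′ → descents N′ T′ + 1 ≡ descents N T + bit descentAcross-k
    descents-interior k≤N′ = begin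
      descents N′ T′ + 1                                           ≡⟨ cong (λ z → descentCount ρ′ (z ∸ 1) + 1) N′≡ ⟩
      descentCount ρ′ (suc t + j) + 1                              ≡⟨ cong (_+ 1) (sym (+-identityʳ _)) ⟩
      descentCount ρ′ (suc t + j) + 0 + 1                          ≡⟨ cong₂ (λ a b → descentCount ρ′ (suc t + j) + bit a + bit b)
                                                                          (sym no-descent-before-k) (sym descent-at-k) ⟩
      descentCount ρ′ (suc t + j) + bit (descentAt ρ (suc t)) + bit (descentAt ρ (suc (suc t)))
                                                                   ≡⟨ descentCount-beyond j ⟩
      descentCount ρ (suc (suc t + j)) + bit (descentAt ρ′ (suc t))
                                                                   ≡⟨ cong₂ (λ a b → descentCount ρ a + bit b) (sym N′≡) descentAt-ρ′ ⟩
      descents N T + bit descentAcross-k                           ∎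
      where
      open ≡-Reasoning
      j = N′ ∸ suc (suc t)
      N′≡ : N′ ≡ suc (suc t + j)
      N′≡ = sym (m+[n∸m]≡n k≤N′)

    descents-k-last : N′ ≡ suc t → descents N′ T′ ≡ descents N T
    descents-k-last N′≡ = begin
      descents N′ T′                              ≡⟨ cong (λ z → descentCount ρ′ (z ∸ 1)) N′≡ ⟩
      descentCount ρ′ t                           ≡⟨ sym (+-identityʳ _) ⟩
      descentCount ρ′ t + 0                       ≡⟨ cong (λ b → descentCount ρ′ t + bit b) (sym no-descent-before-k) ⟩
      descentCount ρ′ t + bit (descentAt ρ (suc t)) ≡⟨ descentCount-upTo-last ⟩
      descentCount ρ (suc t)                      ≡⟨ cong (descentCount ρ) (sym N′≡) ⟩
      descents N T                                ∎
      where open ≡-Reasoning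

    descentAcross-row₂ : suc k ≢ r₃ → suc k ≤ N → descentAcross-k ≡ (lastOr0 L₁ ≡ᵇ suc t)
    descentAcross-row₂ k+1≢r₃ k+1≤N = begin
      ρ (suc t) <ᵇ ρ (suc (suc (suc t)))    ≡⟨ cong (ρ (suc t) <ᵇ_) (trans (cong (ρ ∘ suc) (sym k≡t+2))
                                                                        (rowOf-suc-k k+1≢r₃ k+1≤N)) ⟩
      ρ (suc t) <ᵇ 2                        ≡⟨ rowOf-<2 (L₁ ++ [ k ]) r₂ r₃ (suc t) ⟩
      elem (suc t) (L₁ ++ [ k ])            ≡⟨ elem-++ (suc t) L₁ [ k ] ⟩
      elem (suc t) L₁ ∨ elem (suc t) [ k ]  ≡⟨ cong (elem (suc t) L₁ ∨_) (trans (∨-identityʳ _)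
                                                                                (≢⇒≡ᵇ-false (suc t) k t+1≢k)) ⟩
      elem (suc t) L₁ ∨ false               ≡⟨ ∨-identityʳ _ ⟩
      elem (suc t) L₁                       ≡⟨ elem-increasing (suc t) L₁ (λ ()) L₁-increasing
                                                 (All.map (λ x<k → ≤-pred (subst (_ <_) k≡t+2 x<k)) L₁<k) ⟩
      lastOr0 L₁ ≡ᵇ suc t                   ∎
      where
      open ≡-Reasoning
      t+1≢k : suc t ≢ k
      t+1≢k e = 1+n≢n (sym (trans e k≡t+2))

    descentAcross-row₃ : suc k ≡ r₃ → descentAcross-k ≡ true
    descentAcross-row₃ k+1≡r₃ = begin
      ρ (suc t) <ᵇ ρ (suc (suc (suc t)))           ≡⟨ cong (ρ (suc t) <ᵇ_) (trans (cong (ρ ∘ suc) (sym k≡t+2))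
                                                        (trans (cong ρ k+1≡r₃) rowOf-r₃)) ⟩
      ρ (suc t) <ᵇ 3                               ≡⟨ rowOf-<3 (L₁ ++ [ k ]) r₂ r₃ (suc t) ⟩
      elem (suc t) (L₁ ++ [ k ]) ∨ elem (suc t) r₂ ≡⟨ row₁₂-except-r₃ (suc t) t+1∈ t+1≢r₃ ⟩
      true                                         ∎
      where
      open ≡-Reasoning
      t+1∈ : suc t ∈ vals N
      t+1∈ = bounds⇒∈vals (s≤s z≤n) (≤-trans (n≤1+n (suc t)) (subst (_≤ N) k≡t+2 k≤N))
      t+1≢r₃ : suc t ≢ r₃
      t+1≢r₃ e = <⇒≢ (m<n⇒m<1+n (n<1+n (suc t))) (trans e (trans (sym k+1≡r₃) (cong suc k≡t+2)))

    descents-drop : suc (suc t) ≤ N′ → suc k ≢ r₃ →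
                    descents N′ T′ + 1 ≡ descents N T + bit (lastOr0 L₁ ≡ᵇ suc t)
    descents-drop k≤N′ k+1≢r₃ = trans (descents-interior k≤N′)
      (cong (λ b → descents N T + bit b) (descentAcross-row₂ k+1≢r₃ (subst (λ z → suc z ≤ N) (sym k≡t+2) (s≤s k≤N′))))

    descents-kept : suc k ≡ r₃ ⊎ k ≡ N → descents N′ T′ ≡ descents N T
    descents-kept (inj₁ k+1≡r₃) = +-cancelʳ-≡ 1 _ _ (trans (descents-interior k≤N′)
      (cong (λ b → descents N T + bit b) (descentAcross-row₃ k+1≡r₃)))
      where
      k≤N′ : suc (suc t) ≤ N′
      k≤N′ = ≤-pred (subst (_≤ N) (sym (trans (cong suc (sym k≡t+2)) k+1≡r₃)) (proj₂ (∈vals⇒bounds range₃)))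
    descents-kept (inj₂ k≡N) = descents-k-last (suc-injective (trans (sym k≡N) k≡t+2))

module Insertion (n′ m k : ℕ) (s₁ s₂ : List ℕ) (s₃ : ℕ) (m≤n′ : m ≤ n′) (1≤n′ : 1 ≤ n′)
                 (1≤k : 1 ≤ k) (k≤N : k ≤ suc (n′ + m + 1))
                 (S∈ : (s₁ , s₂ , s₃) ∈ fillings n′ m)
                 (S-syt : isSYT (n′ + m + 1) (s₁ , s₂ , s₃) ≡ true)
                 (lastOr0-s₁<k : lastOr0 s₁ < k) where

  N′ = n′ + m + 1
  N  = suc N′

  S-entries = entries (s₁ , s₂ , s₃)

  open IsFilling (∈-fillings⁻ {n′} {m} S∈)
  open SYT (isSYT⇒SYT N′ s₁ s₂ s₃ S-syt)

  s₁≢[] : s₁ ≢ []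
  s₁≢[] s₁≡[] = <⇒≢ 1≤n′ (sym (trans (sym length₁) (cong length s₁≡[])))

  s₁<k : All (_< k) s₁
  s₁<k = All.map (λ x≤last → ≤-<-trans x≤last lastOr0-s₁<k) (increasing-All≤lastOr0 s₁ increasing₁)

  punchIn-s₁ : map (punchIn k) s₁ ≡ s₁
  punchIn-s₁ = map-id-local (All.map (λ {x} → punchIn-< k x) s₁<k)

  punchIn-∈vals : ∀ {x} → x ∈ vals N′ → punchIn k x ∈ vals N
  punchIn-∈vals x∈ = let (1≤x , x≤N′) = ∈vals⇒bounds x∈ ; (lo , hi) = punchIn-bounds k 1≤x x≤N′ in
                     bounds⇒∈vals lo hi

  insertEntry-∈fillings : insertEntry k (s₁ , s₂ , s₃) ∈ fillings (suc n′) m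
  insertEntry-∈fillings = ∈-fillings⁺ record
    { length₁ = trans (length-++ s₁) (trans (+-comm (length s₁) 1) (cong suc length₁))
    ; length₂ = trans (length-map (punchIn k) s₂) length₂
    ; range₁  = All.++⁺ (All.zipWith (λ { {x} (x∈ , x<k) → subst (_∈ vals N) (punchIn-< k x x<k) (punchIn-∈vals x∈) })
                                     (range₁ , s₁<k))
                        (bounds⇒∈vals 1≤k k≤N ∷ [])
    ; range₂  = All.map⁺ (All.map punchIn-∈vals range₂)
    ; range₃  = punchIn-∈vals range₃ }

  deleteEntry-insertEntry : deleteEntry k (insertEntry k (s₁ , s₂ , s₃)) ≡ (s₁ , s₂ , s₃)
  deleteEntry-insertEntry = cong₂ _,_ (init-∷ʳ s₁ k)
    (cong₂ _,_ (trans (sym (map-∘ s₂)) (map-id-local (All.tabulate (λ {x} _ → punchOut-punchIn k x))))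
               (punchOut-punchIn k s₃))

  occ-inserted : ∀ v → occ v ((s₁ ++ [ k ]) ++ map (punchIn k) s₂ ++ [ punchIn k s₃ ])
                     ≡ occ v (map (punchIn k) S-entries) + occ v [ k ]
  occ-inserted v = begin
    occ v ((s₁ ++ [ k ]) ++ map (punchIn k) s₂ ++ [ punchIn k s₃ ]) ≡⟨ cong (occ v) (++-assoc s₁ [ k ] _) ⟩
    occ v (s₁ ++ k ∷ map (punchIn k) s₂ ++ [ punchIn k s₃ ])        ≡⟨ occ-middle v s₁ k _ ⟩
    occ v (s₁ ++ map (punchIn k) s₂ ++ [ punchIn k s₃ ]) + occ v [ k ] ≡⟨ cong (λ xs → occ v xs + occ v [ k ]) entries-inserted ⟩
    occ v (map (punchIn k) S-entries) + occ v [ k ]                   ∎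
    where
    open ≡-Reasoning
    entries-inserted : s₁ ++ map (punchIn k) s₂ ++ [ punchIn k s₃ ] ≡ map (punchIn k) S-entries
    entries-inserted = sym (trans (map-++ (punchIn k) s₁ (s₂ ++ [ s₃ ]))
                                  (cong₂ _++_ punchIn-s₁ (map-++ (punchIn k) s₂ [ s₃ ])))

  inserted-once : EachOnce N ((s₁ ++ [ k ]) ++ map (punchIn k) s₂ ++ [ punchIn k s₃ ])
  inserted-once v v∈ with v ≟ k
  ... | yes refl = trans (occ-inserted k) (cong₂ _+_
        (All≢⇒occ≡0 k (map (punchIn k) S-entries) (All.map⁺ (All.tabulate (λ {x} _ → punchIn≢ k x))))
        (occ-∷-self k []))
  ... | no v≢k = begin
    occ v ((s₁ ++ [ k ]) ++ map (punchIn k) s₂ ++ [ punchIn k s₃ ]) ≡⟨ occ-inserted v ⟩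
    occ v (map (punchIn k) S-entries) + occ v [ k ]                   ≡⟨ cong₂ _+_
                                                                         (occ-map (punchIn k) v (punchOut k v) S-entries
                                                                           (All.tabulate (λ {x} _ → ≡ᵇ-punchIn k v x v≢k)))
                                                                         (All≢⇒occ≡0 v [ k ] ((v≢k ∘ sym) ∷ [])) ⟩
    occ (punchOut k v) S-entries + 0                                  ≡⟨ +-identityʳ _ ⟩
    occ (punchOut k v) S-entries                                      ≡⟨ once (punchOut k v) (bounds⇒∈vals lo hi) ⟩
    1                                                               ∎
    where
    open ≡-Reasoning
    bounds = ∈vals⇒bounds v∈
    lo = proj₁ (punchOut-bounds 1≤k k≤N (proj₁ bounds) (proj₂ bounds) v≢k)
    hi = proj₂ (punchOut-bounds 1≤k k≤N (proj₁ bounds) (proj₂ bounds) v≢k)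

  insertEntry-SYT : isSYT N (insertEntry k (s₁ , s₂ , s₃)) ≡ true
  insertEntry-SYT = SYT⇒isSYT N (s₁ ++ [ k ]) (map (punchIn k) s₂) (punchIn k s₃) record
    { once        = inserted-once
    ; increasing₁ = increasing-∷ʳ⁺ s₁ k increasing₁ s₁<k
    ; increasing₂ = increasing-map (λ _ → ⊤) (punchIn k) (λ _ _ → punchIn-mono-< k) s₂ (All.tabulate (λ _ → tt)) increasing₂
    ; columns     = columns′
    ; firstColumn = firstColumn′ }
    where
    columns′ : ColumnsIncrease (s₁ ++ [ k ]) (map (punchIn k) s₂)
    columns′ = subst (All _) (sym (zip-∷ʳ s₁ (map (punchIn k) s₂) k
                 (subst₂ _≤_ (sym (trans (length-map (punchIn k) s₂) length₂)) (sym length₁) m≤n′)))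
               (subst (λ r → ColumnsIncrease r (map (punchIn k) s₂)) punchIn-s₁
                 (ColumnsIncrease-map (punchIn k) (punchIn k) (λ _ → ⊤) (λ _ → ⊤) (λ _ _ → punchIn-mono-< k) s₁ s₂
                   (All.tabulate (λ _ → tt)) (All.tabulate (λ _ → tt)) columns))
    firstColumn′ : All (_< punchIn k s₃) (take 1 (s₁ ++ [ k ]) ++ take 1 (map (punchIn k) s₂))
    firstColumn′ = subst₂ (λ a b → All (_< punchIn k s₃) (a ++ b)) (sym (take1-∷ʳ s₁ k s₁≢[])) (sym (take-map 1 s₂))
      (All.++⁺ (All.zipWith (λ { {x} (x<k , x<s₃) → subst (_< punchIn k s₃) (punchIn-< k x x<k) (punchIn-mono-< k x<s₃) })
                            (All.take⁺ 1 s₁<k , All.++⁻ˡ (take 1 s₁) firstColumn))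
               (All.map⁺ (All.map (punchIn-mono-< k) (All.++⁻ʳ (take 1 s₁) firstColumn))))

  module Inserted = Deletion n′ m k s₁ (map (punchIn k) s₂) (punchIn k s₃) m≤n′ 1≤n′
                             insertEntry-∈fillings insertEntry-SYT

  Inserted-T′ : Inserted.T′ ≡ (s₁ , s₂ , s₃)
  Inserted-T′ = trans (sym Inserted.deleteEntry-T) deleteEntry-insertEntry

counted : ℕ → ℕ → ℕ → ℕ → Filling → Bool
counted N d k c (r₁ , r₂ , r₃) =
  isSYT N (r₁ , r₂ , r₃) ∧ (descents N (r₁ , r₂ , r₃) ≡ᵇ d) ∧ (lastOr0 r₁ ≡ᵇ k) ∧ (r₃ ≡ᵇ c)

countedBelow : ℕ → ℕ → ℕ → ℕ → Filling → Bool
countedBelow N d b c (r₁ , r₂ , r₃) =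
  isSYT N (r₁ , r₂ , r₃) ∧ (descents N (r₁ , r₂ , r₃) ≡ᵇ d) ∧ (lastOr0 r₁ <ᵇ b) ∧ (r₃ ≡ᵇ c)

count-by-deletion : ∀ n′ m k (p q : Filling → Bool) → m ≤ n′ → 1 ≤ n′ → 1 ≤ k → k ≤ suc (n′ + m + 1) →
  (p⇒ : ∀ r₁ r₂ r₃ → p (r₁ , r₂ , r₃) ≡ true →
        lastOr0 r₁ ≡ k × isSYT (suc (n′ + m + 1)) (r₁ , r₂ , r₃) ≡ true) →
  (p⇒q : ∀ L₁ r₂ r₃ → (T∈ : (L₁ ++ [ k ] , r₂ , r₃) ∈ fillings (suc n′) m) →
         (T-syt : isSYT (suc (n′ + m + 1)) (L₁ ++ [ k ] , r₂ , r₃) ≡ true) →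
         p (L₁ ++ [ k ] , r₂ , r₃) ≡ true → q (L₁ , map (punchOut k) r₂ , punchOut k r₃) ≡ true) →
  (q⇒ : ∀ s₁ s₂ s₃ → q (s₁ , s₂ , s₃) ≡ true → isSYT (n′ + m + 1) (s₁ , s₂ , s₃) ≡ true × lastOr0 s₁ < k) →
  (q⇒p : ∀ s₁ s₂ s₃ → (s₁ , s₂ , s₃) ∈ fillings n′ m → isSYT (n′ + m + 1) (s₁ , s₂ , s₃) ≡ true →
         lastOr0 s₁ < k → q (s₁ , s₂ , s₃) ≡ true → p (insertEntry k (s₁ , s₂ , s₃)) ≡ true) →
  countᵇ p (fillings (suc n′) m) ≡ countᵇ q (fillings n′ m)
count-by-deletion n′ m k p q m≤n′ 1≤n′ 1≤k k≤N p⇒ p⇒q q⇒ q⇒p =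
  countᵇ-bijection (fillings (suc n′) m) (fillings n′ m) p q (deleteEntry k) (insertEntry k)
                   (fillings-unique (suc n′) m) (fillings-unique n′ m) forward backward
  where
  Deletable : Filling → Set
  Deletable T = deleteEntry k T ∈ fillings n′ m × q (deleteEntry k T) ≡ true × insertEntry k (deleteEntry k T) ≡ T

  deletable : ∀ L₁ r₂ r₃ → (L₁ ++ [ k ] , r₂ , r₃) ∈ fillings (suc n′) m → p (L₁ ++ [ k ] , r₂ , r₃) ≡ true →
              Deletable (L₁ ++ [ k ] , r₂ , r₃)
  deletable L₁ r₂ r₃ T∈ pT =
    subst (λ T′ → T′ ∈ fillings n′ m × q T′ ≡ true × insertEntry k T′ ≡ (L₁ ++ [ k ] , r₂ , r₃))
          (sym deleteEntry-T) (T′∈fillings , p⇒q L₁ r₂ r₃ T∈ T-syt pT , insertEntry-T′)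
    where
    T-syt = proj₂ (p⇒ (L₁ ++ [ k ]) r₂ r₃ pT)
    open Deletion n′ m k L₁ r₂ r₃ m≤n′ 1≤n′ T∈ T-syt

  forward : ∀ {T} → T ∈ fillings (suc n′) m → p T ≡ true → Deletable T
  forward {[] , r₂ , r₃} T∈ _ with () ← IsFilling.length₁ (∈-fillings⁻ {suc n′} {m} T∈)
  forward {x ∷ xs , r₂ , r₃} T∈ pT =
    subst Deletable (sym T≡) (deletable (init (x ∷ xs)) r₂ r₃ (subst (_∈ _) T≡ T∈) (subst (λ T → p T ≡ true) T≡ pT))
    where
    T≡ : (x ∷ xs , r₂ , r₃) ≡ (init (x ∷ xs) ++ [ k ] , r₂ , r₃)
    T≡ = cong (λ r → (r , r₂ , r₃))
      (trans (init-++-lastOr0 x xs) (cong (λ z → init (x ∷ xs) ++ [ z ]) (proj₁ (p⇒ (x ∷ xs) r₂ r₃ pT))))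

  backward : ∀ {S} → S ∈ fillings n′ m → q S ≡ true →
             insertEntry k S ∈ fillings (suc n′) m × p (insertEntry k S) ≡ true × deleteEntry k (insertEntry k S) ≡ S
  backward {s₁ , s₂ , s₃} S∈ qS = insertEntry-∈fillings , q⇒p s₁ s₂ s₃ S∈ S-syt last<k qS , deleteEntry-insertEntry
    where
    S-syt  = proj₁ (q⇒ s₁ s₂ s₃ qS)
    last<k = proj₂ (q⇒ s₁ s₂ s₃ qS)
    open Insertion n′ m k s₁ s₂ s₃ m≤n′ 1≤n′ 1≤k k≤N S∈ S-syt last<k

counted⇒ : ∀ N d k c r₁ r₂ r₃ → counted N d k c (r₁ , r₂ , r₃) ≡ true →
  isSYT N (r₁ , r₂ , r₃) ≡ true × descents N (r₁ , r₂ , r₃) ≡ d × lastOr0 r₁ ≡ k × r₃ ≡ c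
counted⇒ N d k c r₁ r₂ r₃ h =
  ∧-projˡ h , ≡ᵇ-true⇒≡ _ _ (∧-projˡ h₁) , ≡ᵇ-true⇒≡ _ _ (∧-projˡ h₂) , ≡ᵇ-true⇒≡ _ _ (∧-projʳ h₂)
  where
  h₁ = ∧-projʳ {isSYT N (r₁ , r₂ , r₃)} h
  h₂ = ∧-projʳ {descents N (r₁ , r₂ , r₃) ≡ᵇ d} h₁

countedBelow⇒ : ∀ N d b c r₁ r₂ r₃ → countedBelow N d b c (r₁ , r₂ , r₃) ≡ true →
  isSYT N (r₁ , r₂ , r₃) ≡ true × descents N (r₁ , r₂ , r₃) ≡ d × lastOr0 r₁ < b × r₃ ≡ c
countedBelow⇒ N d b c r₁ r₂ r₃ h =
  ∧-projˡ h , ≡ᵇ-true⇒≡ _ _ (∧-projˡ h₁) , <ᵇ-true⇒< _ _ (∧-projˡ h₂) , ≡ᵇ-true⇒≡ _ _ (∧-projʳ h₂)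
  where
  h₁ = ∧-projʳ {isSYT N (r₁ , r₂ , r₃)} h
  h₂ = ∧-projʳ {descents N (r₁ , r₂ , r₃) ≡ᵇ d} h₁

counted-intro : ∀ N d k c r₁ r₂ r₃ → isSYT N (r₁ , r₂ , r₃) ≡ true → descents N (r₁ , r₂ , r₃) ≡ d →
                lastOr0 r₁ ≡ k → r₃ ≡ c → counted N d k c (r₁ , r₂ , r₃) ≡ true
counted-intro N d k c r₁ r₂ r₃ syt refl refl refl =
  ∧-intro syt (∧-intro (≡⇒≡ᵇ-true {descents N (r₁ , r₂ , r₃)} refl)
              (∧-intro (≡⇒≡ᵇ-true {lastOr0 r₁} refl) (≡⇒≡ᵇ-true {r₃} refl)))

countedBelow-intro : ∀ N d b c r₁ r₂ r₃ → isSYT N (r₁ , r₂ , r₃) ≡ true → descents N (r₁ , r₂ , r₃) ≡ d →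
                     lastOr0 r₁ < b → r₃ ≡ c → countedBelow N d b c (r₁ , r₂ , r₃) ≡ true
countedBelow-intro N d b c r₁ r₂ r₃ syt refl last<b refl =
  ∧-intro syt (∧-intro (≡⇒≡ᵇ-true {descents N (r₁ , r₂ , r₃)} refl)
              (∧-intro (<⇒<ᵇ-true last<b) (≡⇒≡ᵇ-true {r₃} refl)))

-- A tableau ending its first row at t + 1 keeps its descent number, any other loses one.
countedSplit : ℕ → ℕ → ℕ → ℕ → Filling → Bool
countedSplit N d′ t c T = counted N (suc d′) (suc t) c T ∨ countedBelow N d′ (suc t) c T

countedSplit-intro : ∀ N d′ t c s₁ s₂ s₃ → isSYT N (s₁ , s₂ , s₃) ≡ true → lastOr0 s₁ < suc (suc t) → s₃ ≡ c →
  descents N (s₁ , s₂ , s₃) + 1 ≡ suc d′ + bit (lastOr0 s₁ ≡ᵇ suc t) → countedSplit N d′ t c (s₁ , s₂ , s₃) ≡ true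
countedSplit-intro N d′ t c s₁ s₂ s₃ syt last<t+2 s₃≡c rel = by-last (lastOr0 s₁ ≡ᵇ suc t) refl
  where
  rel′ : ∀ {b} → (lastOr0 s₁ ≡ᵇ suc t) ≡ b → descents N (s₁ , s₂ , s₃) + 1 ≡ suc d′ + bit b
  rel′ e = trans rel (cong (λ b → suc d′ + bit b) e)
  by-last : ∀ b → (lastOr0 s₁ ≡ᵇ suc t) ≡ b → countedSplit N d′ t c (s₁ , s₂ , s₃) ≡ true
  by-last true  e = ∨-introˡ (counted-intro N (suc d′) (suc t) c s₁ s₂ s₃ syt
                               (+-cancelʳ-≡ 1 _ _ (rel′ e)) (≡ᵇ-true⇒≡ _ _ e) s₃≡c)
  by-last false e = ∨-introʳ (countedBelow-intro N d′ (suc t) c s₁ s₂ s₃ syt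
                               (+-cancelʳ-≡ 1 _ _ (trans (rel′ e) (trans (+-identityʳ (suc d′)) (+-comm 1 d′))))
                               (≤∧≢⇒< (≤-pred last<t+2) (≡ᵇ-false⇒≢ _ _ e)) s₃≡c)

countedSplit⇒ : ∀ N d′ t c s₁ s₂ s₃ → countedSplit N d′ t c (s₁ , s₂ , s₃) ≡ true →
  isSYT N (s₁ , s₂ , s₃) ≡ true × lastOr0 s₁ < suc (suc t) × s₃ ≡ c ×
  descents N (s₁ , s₂ , s₃) + 1 ≡ suc d′ + bit (lastOr0 s₁ ≡ᵇ suc t)
countedSplit⇒ N d′ t c s₁ s₂ s₃ h with counted N (suc d′) (suc t) c (s₁ , s₂ , s₃) in e
... | true with counted⇒ N (suc d′) (suc t) c s₁ s₂ s₃ e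
...   | syt , desc , last≡ , s₃≡c = syt , s≤s (≤-reflexive last≡) , s₃≡c , (begin
  descents N (s₁ , s₂ , s₃) + 1        ≡⟨ cong (_+ 1) desc ⟩
  suc d′ + 1                           ≡⟨ cong (λ b → suc d′ + bit b) (sym (≡⇒≡ᵇ-true last≡)) ⟩
  suc d′ + bit (lastOr0 s₁ ≡ᵇ suc t)   ∎)
  where open ≡-Reasoning
countedSplit⇒ N d′ t c s₁ s₂ s₃ h | false with countedBelow⇒ N d′ (suc t) c s₁ s₂ s₃ h
...   | syt , desc , last< , s₃≡c = syt , m<n⇒m<1+n last< , s₃≡c , (begin
  descents N (s₁ , s₂ , s₃) + 1        ≡⟨ cong (_+ 1) desc ⟩
  d′ + 1                               ≡⟨ +-comm d′ 1 ⟩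
  suc d′                               ≡⟨ sym (+-identityʳ (suc d′)) ⟩
  suc d′ + 0                           ≡⟨ cong (λ b → suc d′ + bit b) (sym (≢⇒≡ᵇ-false _ _ (<⇒≢ last<))) ⟩
  suc d′ + bit (lastOr0 s₁ ≡ᵇ suc t)   ∎)
  where open ≡-Reasoning

count-descent-drops : ∀ n′ m t d′ c c′ → m ≤ n′ → 1 ≤ n′ → suc (suc t) ≤ n′ + m + 1 → suc (suc (suc t)) ≢ c →
  punchOut (suc (suc t)) c ≡ c′ → punchIn (suc (suc t)) c′ ≡ c →
  countᵇ (counted (suc (n′ + m + 1)) (suc d′) (suc (suc t)) c) (fillings (suc n′) m)
  ≡ countᵇ (countedSplit (n′ + m + 1) d′ t c′) (fillings n′ m)
count-descent-drops n′ m t d′ c c′ m≤n′ 1≤n′ k≤N′ k+1≢c c↦c′ c′↦c =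
  count-by-deletion n′ m k _ _ m≤n′ 1≤n′ (s≤s z≤n) (m≤n⇒m≤1+n k≤N′) p⇒ p⇒q q⇒ q⇒p
  where
  k  = suc (suc t)
  N′ = n′ + m + 1
  N  = suc N′

  p⇒ : ∀ r₁ r₂ r₃ → counted N (suc d′) k c (r₁ , r₂ , r₃) ≡ true →
       lastOr0 r₁ ≡ k × isSYT N (r₁ , r₂ , r₃) ≡ true
  p⇒ r₁ r₂ r₃ h = let (syt , _ , last≡k , _) = counted⇒ N (suc d′) k c r₁ r₂ r₃ h in last≡k , syt

  p⇒q : ∀ L₁ r₂ r₃ → (T∈ : (L₁ ++ [ k ] , r₂ , r₃) ∈ fillings (suc n′) m) →
        (T-syt : isSYT N (L₁ ++ [ k ] , r₂ , r₃) ≡ true) → counted N (suc d′) k c (L₁ ++ [ k ] , r₂ , r₃) ≡ true →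
        countedSplit N′ d′ t c′ (L₁ , map (punchOut k) r₂ , punchOut k r₃) ≡ true
  p⇒q L₁ r₂ r₃ T∈ T-syt h =
    countedSplit-intro N′ d′ t c′ L₁ _ _ T′-SYT lastOr0-L₁<k (trans (cong (punchOut k) r₃≡c) c↦c′)
      (trans (descents-drop k≤N′ (λ e → k+1≢c (trans e r₃≡c))) (cong (λ d → d + bit (lastOr0 L₁ ≡ᵇ suc t)) desc))
    where
    open Deletion n′ m k L₁ r₂ r₃ m≤n′ 1≤n′ T∈ T-syt hiding (N; N′)
    open Descents t refl
    parts = counted⇒ N (suc d′) k c (L₁ ++ [ k ]) r₂ r₃ h
    desc  = proj₁ (proj₂ parts)
    r₃≡c  = proj₂ (proj₂ (proj₂ parts))

  q⇒ : ∀ s₁ s₂ s₃ → countedSplit N′ d′ t c′ (s₁ , s₂ , s₃) ≡ true →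
       isSYT N′ (s₁ , s₂ , s₃) ≡ true × lastOr0 s₁ < k
  q⇒ s₁ s₂ s₃ h = let (syt , last<k , _) = countedSplit⇒ N′ d′ t c′ s₁ s₂ s₃ h in syt , last<k

  q⇒p : ∀ s₁ s₂ s₃ → (s₁ , s₂ , s₃) ∈ fillings n′ m → isSYT N′ (s₁ , s₂ , s₃) ≡ true → lastOr0 s₁ < k →
        countedSplit N′ d′ t c′ (s₁ , s₂ , s₃) ≡ true → counted N (suc d′) k c (insertEntry k (s₁ , s₂ , s₃)) ≡ true
  q⇒p s₁ s₂ s₃ S∈ S-syt last<k h =
    counted-intro N (suc d′) k c (s₁ ++ [ k ]) _ _ insertEntry-SYT desc (lastOr0-∷ʳ s₁ k) s₃↦c
    where
    open Insertion n′ m k s₁ s₂ s₃ m≤n′ 1≤n′ (s≤s z≤n) (m≤n⇒m≤1+n k≤N′) S∈ S-syt last<k hiding (N; N′)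
    open Inserted.Descents t refl
    parts = countedSplit⇒ N′ d′ t c′ s₁ s₂ s₃ h
    s₃↦c : punchIn k s₃ ≡ c
    s₃↦c = trans (cong (punchIn k) (proj₁ (proj₂ (proj₂ parts)))) c′↦c
    desc : descents N (insertEntry k (s₁ , s₂ , s₃)) ≡ suc d′
    desc = +-cancelʳ-≡ (bit (lastOr0 s₁ ≡ᵇ suc t)) _ _ (begin
      descents N (insertEntry k (s₁ , s₂ , s₃)) + bit (lastOr0 s₁ ≡ᵇ suc t)
        ≡⟨ sym (descents-drop k≤N′ (λ e → k+1≢c (trans e s₃↦c))) ⟩
      descents N′ Inserted.T′ + 1
        ≡⟨ cong (λ S → descents N′ S + 1) Inserted-T′ ⟩
      descents N′ (s₁ , s₂ , s₃) + 1
        ≡⟨ proj₂ (proj₂ (proj₂ parts)) ⟩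
      suc d′ + bit (lastOr0 s₁ ≡ᵇ suc t)
        ∎)
      where open ≡-Reasoning

count-descent-kept : ∀ n′ m t d c c′ → m ≤ n′ → 1 ≤ n′ → suc (suc t) ≤ suc (n′ + m + 1) →
  suc (suc (suc t)) ≡ c ⊎ suc (suc t) ≡ suc (n′ + m + 1) →
  punchOut (suc (suc t)) c ≡ c′ → punchIn (suc (suc t)) c′ ≡ c →
  countᵇ (counted (suc (n′ + m + 1)) d (suc (suc t)) c) (fillings (suc n′) m)
  ≡ countᵇ (countedBelow (n′ + m + 1) d (suc (suc t)) c′) (fillings n′ m)
count-descent-kept n′ m t d c c′ m≤n′ 1≤n′ k≤N k+1∈row₃-or-k-last c↦c′ c′↦c =
  count-by-deletion n′ m k _ _ m≤n′ 1≤n′ (s≤s z≤n) k≤N p⇒ p⇒q q⇒ q⇒p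
  where
  k  = suc (suc t)
  N′ = n′ + m + 1
  N  = suc N′

  kept : ∀ {r₃} → r₃ ≡ c → suc k ≡ r₃ ⊎ k ≡ N
  kept r₃≡c = map⊎ (λ e → trans e (sym r₃≡c)) (λ e → e) k+1∈row₃-or-k-last

  p⇒ : ∀ r₁ r₂ r₃ → counted N d k c (r₁ , r₂ , r₃) ≡ true → lastOr0 r₁ ≡ k × isSYT N (r₁ , r₂ , r₃) ≡ true
  p⇒ r₁ r₂ r₃ h = let (syt , _ , last≡k , _) = counted⇒ N d k c r₁ r₂ r₃ h in last≡k , syt

  p⇒q : ∀ L₁ r₂ r₃ → (T∈ : (L₁ ++ [ k ] , r₂ , r₃) ∈ fillings (suc n′) m) →
        (T-syt : isSYT N (L₁ ++ [ k ] , r₂ , r₃) ≡ true) → counted N d k c (L₁ ++ [ k ] , r₂ , r₃) ≡ true →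
        countedBelow N′ d k c′ (L₁ , map (punchOut k) r₂ , punchOut k r₃) ≡ true
  p⇒q L₁ r₂ r₃ T∈ T-syt h =
    countedBelow-intro N′ d k c′ L₁ _ _ T′-SYT (trans (descents-kept (kept r₃≡c)) desc) lastOr0-L₁<k
                       (trans (cong (punchOut k) r₃≡c) c↦c′)
    where
    open Deletion n′ m k L₁ r₂ r₃ m≤n′ 1≤n′ T∈ T-syt hiding (N; N′)
    open Descents t refl
    parts = counted⇒ N d k c (L₁ ++ [ k ]) r₂ r₃ h
    desc  = proj₁ (proj₂ parts)
    r₃≡c  = proj₂ (proj₂ (proj₂ parts))

  q⇒ : ∀ s₁ s₂ s₃ → countedBelow N′ d k c′ (s₁ , s₂ , s₃) ≡ true →
       isSYT N′ (s₁ , s₂ , s₃) ≡ true × lastOr0 s₁ < k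
  q⇒ s₁ s₂ s₃ h = let (syt , _ , last<k , _) = countedBelow⇒ N′ d k c′ s₁ s₂ s₃ h in syt , last<k

  q⇒p : ∀ s₁ s₂ s₃ → (s₁ , s₂ , s₃) ∈ fillings n′ m → isSYT N′ (s₁ , s₂ , s₃) ≡ true → lastOr0 s₁ < k →
        countedBelow N′ d k c′ (s₁ , s₂ , s₃) ≡ true → counted N d k c (insertEntry k (s₁ , s₂ , s₃)) ≡ true
  q⇒p s₁ s₂ s₃ S∈ S-syt last<k h =
    counted-intro N d k c (s₁ ++ [ k ]) _ _ insertEntry-SYT desc (lastOr0-∷ʳ s₁ k) s₃↦c
    where
    open Insertion n′ m k s₁ s₂ s₃ m≤n′ 1≤n′ (s≤s z≤n) k≤N S∈ S-syt last<k hiding (N; N′)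
    open Inserted.Descents t refl
    parts = countedBelow⇒ N′ d k c′ s₁ s₂ s₃ h
    s₃↦c : punchIn k s₃ ≡ c
    s₃↦c = trans (cong (punchIn k) (proj₂ (proj₂ (proj₂ parts)))) c′↦c
    desc : descents N (insertEntry k (s₁ , s₂ , s₃)) ≡ d
    desc = trans (sym (descents-kept (kept s₃↦c)))
                 (trans (cong (descents N′) Inserted-T′) (proj₁ (proj₂ parts)))

-- Summing over the end of the first row

countᵇ-+ : ∀ {A : Set} (p q r : A → Bool) → (∀ x → bit (p x) + bit (q x) ≡ bit (r x)) →
           ∀ xs → countᵇ p xs + countᵇ q xs ≡ countᵇ r xs
countᵇ-+ p q r pq≗r []       = refl
countᵇ-+ p q r pq≗r (x ∷ xs) = begin
  countᵇ p (x ∷ xs) + countᵇ q (x ∷ xs)                      ≡⟨ cong₂ _+_ (countᵇ-∷ p x xs) (countᵇ-∷ q x xs) ⟩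
  bit (p x) + countᵇ p xs + (bit (q x) + countᵇ q xs)        ≡⟨ +-interchange (bit (p x)) (countᵇ p xs) (bit (q x)) (countᵇ q xs) ⟩
  bit (p x) + bit (q x) + (countᵇ p xs + countᵇ q xs)        ≡⟨ cong₂ _+_ (pq≗r x) (countᵇ-+ p q r pq≗r xs) ⟩
  bit (r x) + countᵇ r xs                                    ≡⟨ sym (countᵇ-∷ r x xs) ⟩
  countᵇ r (x ∷ xs)                                          ∎
  where open ≡-Reasoning

bit-∨-exclusive : ∀ a b → (a ≡ true → b ≡ true → ⊥) → bit a + bit b ≡ bit (a ∨ b)
bit-∨-exclusive true  true  excl = ⊥-elim (excl refl refl)
bit-∨-exclusive true  false _    = refl
bit-∨-exclusive false b     _    = refl

sumBelow-zero : ∀ b → sumBelow b (λ _ → 0) ≡ 0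
sumBelow-zero b = go (upTo b)
  where
  go : ∀ as → sum (map (λ _ → 0) as) ≡ 0
  go []       = refl
  go (_ ∷ as) = go as

sumBelow-cong : ∀ b {f g : ℕ → ℕ} → (∀ a → f a ≡ g a) → sumBelow b f ≡ sumBelow b g
sumBelow-cong b f≗g = cong sum (map-cong f≗g (upTo b))

sumBelow-+ : ∀ b (f g : ℕ → ℕ) → sumBelow b (λ a → f a + g a) ≡ sumBelow b f + sumBelow b g
sumBelow-+ b f g = go (upTo b)
  where
  go : ∀ as → sum (map (λ a → f a + g a) as) ≡ sum (map f as) + sum (map g as)
  go []       = refl
  go (a ∷ as) = trans (cong (f a + g a +_) (go as)) (+-interchange (f a) (g a) _ _)

sumBelow-suc : ∀ b f → sumBelow (suc b) f ≡ sumBelow b f + f b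
sumBelow-suc b f = begin
  sum (map f (upTo (suc b)))              ≡⟨ cong (sum ∘ map f) (sym (applyUpTo-∷ʳ (λ x → x) b)) ⟩
  sum (map f (upTo b ++ [ b ]))           ≡⟨ cong sum (map-++ f (upTo b) [ b ]) ⟩
  sum (map f (upTo b) ++ [ f b ])         ≡⟨ sum-++ (map f (upTo b)) [ f b ] ⟩
  sumBelow b f + (f b + 0)                ≡⟨ cong (sumBelow b f +_) (+-identityʳ (f b)) ⟩
  sumBelow b f + f b                      ∎
  where open ≡-Reasoning

sumBelow-countᵇ : ∀ {A : Set} b (P : ℕ → A → Bool) (Q : A → Bool) →
                  (∀ x → sumBelow b (λ a → bit (P a x)) ≡ bit (Q x)) →
                  ∀ xs → sumBelow b (λ a → countᵇ (P a) xs) ≡ countᵇ Q xs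
sumBelow-countᵇ b P Q ΣP≗Q []       = sumBelow-zero b
sumBelow-countᵇ b P Q ΣP≗Q (x ∷ xs) = begin
  sumBelow b (λ a → countᵇ (P a) (x ∷ xs))
    ≡⟨ sumBelow-cong b (λ a → countᵇ-∷ (P a) x xs) ⟩
  sumBelow b (λ a → bit (P a x) + countᵇ (P a) xs)
    ≡⟨ sumBelow-+ b (λ a → bit (P a x)) (λ a → countᵇ (P a) xs) ⟩
  sumBelow b (λ a → bit (P a x)) + sumBelow b (λ a → countᵇ (P a) xs)
    ≡⟨ cong₂ _+_ (ΣP≗Q x) (sumBelow-countᵇ b P Q ΣP≗Q xs) ⟩
  bit (Q x) + countᵇ Q xs
    ≡⟨ sym (countᵇ-∷ Q x xs) ⟩
  countᵇ Q (x ∷ xs)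
    ∎
  where open ≡-Reasoning

bit-<ᵇ-suc : ∀ l b → bit (l <ᵇ suc b) ≡ bit (l <ᵇ b) + bit (l ≡ᵇ b)
bit-<ᵇ-suc zero    zero    = refl
bit-<ᵇ-suc zero    (suc b) = refl
bit-<ᵇ-suc (suc l) zero    = refl
bit-<ᵇ-suc (suc l) (suc b) = bit-<ᵇ-suc l b

sumBelow-bit-≡ᵇ : ∀ l b → sumBelow b (λ a → bit (l ≡ᵇ a)) ≡ bit (l <ᵇ b)
sumBelow-bit-≡ᵇ l zero    = refl
sumBelow-bit-≡ᵇ l (suc b) = trans (sumBelow-suc b (λ a → bit (l ≡ᵇ a)))
  (trans (cong (_+ bit (l ≡ᵇ b)) (sumBelow-bit-≡ᵇ l b)) (sym (bit-<ᵇ-suc l b)))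

sumBelow-bit-∧-≡ᵇ : ∀ x y z l b → sumBelow b (λ a → bit (x ∧ y ∧ (l ≡ᵇ a) ∧ z)) ≡ bit (x ∧ y ∧ (l <ᵇ b) ∧ z)
sumBelow-bit-∧-≡ᵇ false y     z     l b = sumBelow-zero b
sumBelow-bit-∧-≡ᵇ true  false z     l b = sumBelow-zero b
sumBelow-bit-∧-≡ᵇ true  true  false l b =
  trans (sumBelow-cong b (λ a → cong bit (∧-zeroʳ (l ≡ᵇ a)))) (trans (sumBelow-zero b) (cong bit (sym (∧-zeroʳ (l <ᵇ b)))))
sumBelow-bit-∧-≡ᵇ true  true  true  l b =
  trans (sumBelow-cong b (λ a → cong bit (∧-identityʳ (l ≡ᵇ a))))
        (trans (sumBelow-bit-≡ᵇ l b) (cong bit (sym (∧-identityʳ (l <ᵇ b)))))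

sumBelow-R : ∀ n m d b c → sumBelow b (λ a → R n m d a c) ≡ countᵇ (countedBelow (n + m + 1) d b c) (fillings n m)
sumBelow-R n m d b c = sumBelow-countᵇ b (λ a → counted (n + m + 1) d a c) (countedBelow (n + m + 1) d b c)
  (λ { (r₁ , r₂ , r₃) → sumBelow-bit-∧-≡ᵇ (isSYT (n + m + 1) (r₁ , r₂ , r₃))
                                          (descents (n + m + 1) (r₁ , r₂ , r₃) ≡ᵇ d) (r₃ ≡ᵇ c) (lastOr0 r₁) b })
  (fillings n m)

countedSplit-R : ∀ n m d′ t c → countᵇ (countedSplit (n + m + 1) d′ t c) (fillings n m)
                                ≡ R n m (suc d′) (suc t) c + sumBelow (suc t) (λ a → R n m d′ a c)
countedSplit-R n m d′ t c = begin
  countᵇ (countedSplit N d′ t c) (fillings n m)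
    ≡⟨ sym (countᵇ-+ _ _ _ exclusive (fillings n m)) ⟩
  R n m (suc d′) (suc t) c + countᵇ (countedBelow N d′ (suc t) c) (fillings n m)
    ≡⟨ cong (R n m (suc d′) (suc t) c +_) (sym (sumBelow-R n m d′ (suc t) c)) ⟩
  R n m (suc d′) (suc t) c + sumBelow (suc t) (λ a → R n m d′ a c)
    ∎
  where
  open ≡-Reasoning
  N = n + m + 1
  exclusive : ∀ T → bit (counted N (suc d′) (suc t) c T) + bit (countedBelow N d′ (suc t) c T) ≡ bit (countedSplit N d′ t c T)
  exclusive (r₁ , r₂ , r₃) = bit-∨-exclusive _ _ λ h h′ →
    <⇒≢ (proj₁ (proj₂ (proj₂ (countedBelow⇒ N d′ (suc t) c r₁ r₂ r₃ h′))))
        (proj₁ (proj₂ (proj₂ (counted⇒ N (suc d′) (suc t) c r₁ r₂ r₃ h))))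

R-recursion-k<c-1 : ∀ n′ m d′ t c′ → m ≤ n′ → 1 ≤ n′ → c′ ≤ n′ + m + 1 → suc (suc t) < c′ →
  R (suc n′) m (suc d′) (suc (suc t)) (suc c′) ≡ R n′ m (suc d′) (suc t) c′ + sumBelow (suc t) (λ a → R n′ m d′ a c′)
R-recursion-k<c-1 n′ m d′ t c′ m≤n′ 1≤n′ c′≤N′ k<c′ = trans
  (count-descent-drops n′ m t d′ (suc c′) c′ m≤n′ 1≤n′ (≤-trans (<⇒≤ k<c′) c′≤N′) (<⇒≢ k<c′ ∘ suc-injective)
                       (suc-injective (punchOut-> _ (suc c′) (s≤s (<⇒≤ k<c′)))) (punchIn-≥ _ c′ (<⇒≤ k<c′)))
  (countedSplit-R n′ m d′ t c′)

R-recursion-k≡c-1 : ∀ n′ m d t c′ → m ≤ n′ → 1 ≤ n′ → c′ ≤ n′ + m + 1 → suc (suc t) ≡ c′ →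
  R (suc n′) m d (suc (suc t)) (suc c′) ≡ sumBelow (suc (suc t)) (λ a → R n′ m d a c′)
R-recursion-k≡c-1 n′ m d t c′ m≤n′ 1≤n′ c′≤N′ k≡c′ = trans
  (count-descent-kept n′ m t d (suc c′) c′ m≤n′ 1≤n′ (m≤n⇒m≤1+n (subst (_≤ _) (sym k≡c′) c′≤N′))
                      (inj₁ (cong suc k≡c′))
                      (suc-injective (punchOut-> _ (suc c′) (s≤s (≤-reflexive k≡c′)))) (punchIn-≥ _ c′ (≤-reflexive k≡c′)))
  (sym (sumBelow-R n′ m d (suc (suc t)) c′))

R-recursion-c<k<N : ∀ n′ m d′ t c → m ≤ n′ → 1 ≤ n′ → c < suc (suc t) → suc (suc t) < suc (n′ + m + 1) →
  R (suc n′) m (suc d′) (suc (suc t)) c ≡ R n′ m (suc d′) (suc t) c + sumBelow (suc t) (λ a → R n′ m d′ a c)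
R-recursion-c<k<N n′ m d′ t c m≤n′ 1≤n′ c<k k<N = trans
  (count-descent-drops n′ m t d′ c c m≤n′ 1≤n′ (≤-pred k<N) (λ k+1≡c → <-asym c<k (subst (_ <_) k+1≡c ≤-refl))
                       (punchOut-≤ _ c (<⇒≤ c<k)) (punchIn-< _ c c<k))
  (countedSplit-R n′ m d′ t c)

R-recursion-k≡N : ∀ n′ m d t c → m ≤ n′ → 1 ≤ n′ → c ≤ suc (n′ + m + 1) → c ≢ suc (suc t) →
  suc (suc t) ≡ suc (n′ + m + 1) → R (suc n′) m d (suc (suc t)) c ≡ sumBelow (suc (n′ + m + 1)) (λ a → R n′ m d a c)
R-recursion-k≡N n′ m d t c m≤n′ 1≤n′ c≤N c≢k k≡N = begin
  R (suc n′) m d (suc (suc t)) c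
    ≡⟨ count-descent-kept n′ m t d c c m≤n′ 1≤n′ (≤-reflexive k≡N) (inj₂ k≡N)
                          (punchOut-≤ _ c (<⇒≤ c<k)) (punchIn-< _ c c<k) ⟩
  countᵇ (countedBelow (n′ + m + 1) d (suc (suc t)) c) (fillings n′ m)
    ≡⟨ sym (sumBelow-R n′ m d (suc (suc t)) c) ⟩
  sumBelow (suc (suc t)) (λ a → R n′ m d a c)
    ≡⟨ cong (λ b → sumBelow b (λ a → R n′ m d a c)) k≡N ⟩
  sumBelow (suc (n′ + m + 1)) (λ a → R n′ m d a c)
    ∎
  where
  open ≡-Reasoning
  c<k : c < suc (suc t)
  c<k = ≤∧≢⇒< (subst (c ≤_) (sym k≡N) c≤N) c≢k

mainTheorem7 : (n m d k c : ℕ) → m < n → 1 ≤ m →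
    n ≤ k → k ≤ n + m + 1 → 3 ≤ c → c ≤ n + m + 1 → 2 ≤ d → d ≤ m + 1 → c ≢ k →
    (k < c ∸ 1 → R n m d k c ≡ R (n ∸ 1) m d (k ∸ 1) (c ∸ 1) + sumBelow (k ∸ 1) (λ a → R (n ∸ 1) m (d ∸ 1) a (c ∸ 1)))
    × (k ≡ c ∸ 1 → R n m d k c ≡ sumBelow k (λ a → R (n ∸ 1) m d a (c ∸ 1)))
    × (c < k → k < n + m + 1 → R n m d k c ≡ R (n ∸ 1) m d (k ∸ 1) c + sumBelow (k ∸ 1) (λ a → R (n ∸ 1) m (d ∸ 1) a c))
    × (k ≡ n + m + 1 → R n m d k c ≡ sumBelow (n + m + 1) (λ a → R (n ∸ 1) m d a c))
mainTheorem7 (suc n′) m d (suc zero) c (s≤s m≤n′) 1≤m (s≤s n′≤0) _ _ _ _ _ _ =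
  contradiction (≤-trans 1≤m (≤-trans m≤n′ n′≤0)) λ ()
mainTheorem7 (suc n′) m (suc d′) (suc (suc t)) (suc c′) (s≤s m≤n′) 1≤m _ _ _ (s≤s c′≤N′) _ _ c≢k =
    R-recursion-k<c-1 n′ m d′ t c′ m≤n′ 1≤n′ c′≤N′
  , R-recursion-k≡c-1 n′ m (suc d′) t c′ m≤n′ 1≤n′ c′≤N′
  , R-recursion-c<k<N n′ m d′ t (suc c′) m≤n′ 1≤n′
  , R-recursion-k≡N n′ m (suc d′) t (suc c′) m≤n′ 1≤n′ (s≤s c′≤N′) c≢k
  where
  1≤n′ : 1 ≤ n′
  1≤n′ = ≤-trans 1≤m m≤n′
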